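{- Let $q$ be an odd prime power. There is a reversible partial difference set with parameters $(q^3,q^2+q-2,q-2,q+2)$ in the Heisenberg group $\left\{\left(\begin{smallmatrix}1&x&z\\0&1&y\\0&0&1\end{smallmatrix}\right):x,y,z\in\mathbb{F}_q\right\}$ of dimension $3$ over $\mathbb{F}_q$.
   Context: For a finite group $G$ and $S\subseteq G$, $\underline{S}=\sum_{s\in S}s\in\mathbb{Z}G$, $S^{(-1)}=\{s^{ -1}:s\in S\}$, $G^\#=G\setminus\{e\}$. $S$ is a partial difference set with parameters $(v,k,\lambda,\mu)$ if $|G|=v$, $|S|=k$ and $\underline{S}\cdot\underline{S^{(-1)}}=ke+\lambda\underline{S}+\mu(\underline{G^\#}-\underline{S})$ for nonnegative integers $\lambda,\mu$; it is reversible if $S=S^{(-1)}$. -}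

module Defs where

open import Level using (Level; _⊔_; suc)
open import Data.Nat as ℕ using (ℕ; _^_)
open import Data.Nat.Primality using (Prime)
open import Data.Bool using (Bool; true; false; _∧_; if_then_else_)
open import Data.Fin using (Fin)
open import Data.List using (List; []; _∷_; length; map; concatMap; filter; allFin)
open import Data.Product using (_×_; _,_; Σ; ∃)
open import Data.Integer as ℤ using (ℤ; +_)
open import Relation.Nullary using (¬_; Dec; yes; no)
open import Relation.Binary.PropositionalEquality using (_≡_)
open import Algebra.Bundles using (CommutativeRing)

IsPrimePower : ℕ → Set
IsPrimePower q = Σ ℕ λ p → Σ ℕ λ n → Prime p × (1 ℕ.≤ n) × (q ≡ p ^ n)

record Field (c ℓ : Level) : Set (suc (c ⊔ ℓ)) where
  field
    commutativeRing : CommutativeRing c ℓ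
  open CommutativeRing commutativeRing public
  field
    0≉1  : ¬ (0# ≈ 1#)
    inv  : ∀ x → ¬ (x ≈ 0#) → Σ Carrier λ y → x * y ≈ 1#

record FiniteField (c ℓ : Level) (q : ℕ) : Set (suc (c ⊔ ℓ)) where
  field
    field' : Field c ℓ
  open Field field' public
  field
    _≟_       : ∀ x y → Dec (x ≈ y)
    enum      : Fin q → Carrier
    enum-inj  : ∀ i j → enum i ≈ enum j → i ≡ j
    index     : Carrier → Fin q
    enum-surj : ∀ x → enum (index x) ≈ x

module Heisenberg {c ℓ : Level} {q : ℕ} (F : FiniteField c ℓ q) where
  open FiniteField F

  -- the matrix [[1,x,z],[0,1,y],[0,0,1]] is represented by (x , y , z)
  H : Set c
  H = Carrier × Carrier × Carrier

  _≈H_ : H → H → Set ℓ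
  (x , y , z) ≈H (x' , y' , z') = (x ≈ x') × (y ≈ y') × (z ≈ z')

  _≟H_ : H → H → Bool
  (x , y , z) ≟H (x' , y' , z') with x ≟ x' | y ≟ y' | z ≟ z'
  ... | yes _ | yes _ | yes _ = true
  ... | _     | _     | _     = false

  _·_ : H → H → H
  (x , y , z) · (x' , y' , z') = (x + x' , y + y' , z + z' + x * y')

  e : H
  e = (0# , 0# , 0#)

  _⁻¹ : H → H
  (x , y , z) ⁻¹ = (- x , - y , - z + x * y)

  elems : List H
  elems = concatMap (λ i → concatMap (λ j → map (λ k → (enum i , enum j , enum k))
            (allFin q)) (allFin q)) (allFin q)

  Subset : Set (c ⊔ ℓ)
  Subset = Σ (H → Bool) λ S → ∀ g h → g ≈H h → S g ≡ S h

  card : (H → Bool) → ℕ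
  card S = length (filter (λ g → S g Data.Bool.≟ true) elems)

  -- coefficient of g in  S · S^(-1)  in ℤG : #{(s,t) ∈ S × S : s t⁻¹ = g}
  coefSS⁻¹ : (H → Bool) → H → ℕ
  coefSS⁻¹ S g = length (filter (λ p → (S (Data.Product.proj₁ p) ∧ S (Data.Product.proj₂ p)
                   ∧ ((Data.Product.proj₁ p · (Data.Product.proj₂ p ⁻¹)) ≟H g)) Data.Bool.≟ true)
                   (concatMap (λ s → map (λ t → (s , t)) elems) elems))

  [_] : Bool → ℤ
  [ true ]  = + 1
  [ false ] = + 0

  not' : Bool → Bool
  not' true = false
  not' false = true

  -- coefficient of g in  k e + λ S + μ (G^# − S)
  coefRHS : (H → Bool) → ℕ → ℕ → ℕ → H → ℤ
  coefRHS S k λ' μ g =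
    (+ k) ℤ.* [ g ≟H e ] ℤ.+ (+ λ') ℤ.* [ S g ]
      ℤ.+ (+ μ) ℤ.* ([ not' (g ≟H e) ] ℤ.- [ S g ])

  IsPDS : Subset → ℕ → ℕ → ℕ → ℕ → Set c
  IsPDS (S , _) v k λ' μ =
    (length elems ≡ v) × (card S ≡ k) × (∀ g → + coefSS⁻¹ S g ≡ coefRHS S k λ' μ g)

  IsReversible : Subset → Set c
  IsReversible (S , _) = ∀ g → S (g ⁻¹) ≡ S g

{-# OPTIONS --safe #-}
-- Let A = {(x, y, z) : 2z = xy}, let B = {(0, 0, z)} be the centre, and S = (A ∪ B) ∖ {e}.
-- Since 2 is invertible, A ∩ B = {e}, so 1_S + 2δ_e = 1_A + 1_B; both A and B are closed
-- under inversion, hence so is S.  Write (f ⋆ g)(h) = Σ_s f(s) g(hs); the coefficient of g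
-- in S·S⁻¹ is (1_S ⋆ 1_S)(g⁻¹).  Expanding (1_S + 2δ_e) ⋆ (1_S + 2δ_e) = (1_A + 1_B) ⋆ (1_A + 1_B)
-- reduces everything to counting solutions of linear equations over F_q:
-- 1_A ⋆ 1_B = 1_B ⋆ 1_A = 1, 1_B ⋆ 1_B = q·1_B, and (1_A ⋆ 1_A)(h) + q·1_B(h) = q + q²δ_e(h).
-- Hence (1_S ⋆ 1_S)(h) + 4·1_S(h) + 4δ_e(h) = q + 2 + q²δ_e(h), from which k, λ, μ are read off.
module Submission where

open import Level using (Level)
open import Algebra.Bundles using (CommutativeRing)
import Algebra.Solver.Ring.AlmostCommutativeRing as ACR
open import Data.Bool using (Bool; true; false; _∧_; _∨_; not)
import Data.Bool as Bool
open import Data.Bool.Properties using (∧-zeroʳ)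
open import Data.Empty using (⊥-elim)
open import Data.Fin as Fin using (Fin)
import Data.Fin.Properties as Fin
open import Data.Integer as ℤ using (ℤ; +_; -[1+_])
import Data.Integer.Properties as ℤ
import Data.Integer.Tactic.RingSolver as ℤ
open import Data.List using (List; []; _∷_; _++_; map; concatMap; tabulate; allFin; filter; length)
import Data.List.Properties as List
open import Data.Maybe using (Maybe; just; nothing)
open import Data.Nat as ℕ using (ℕ; zero; suc)
import Data.Nat.DivMod as ℕ
open import Data.Nat.ListAction using (sum)
open import Data.Nat.ListAction.Properties using (sum-++)
import Data.Nat.Properties as ℕ
open import Data.Nat.Tactic.RingSolver using (solve-∀)
open import Data.Product using (Σ; _×_; _,_; proj₁; proj₂)
open import Function using (id; _∘_)
open import Function.Bundles using (_⇔_; mk⇔)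
open import Relation.Binary.Bundles using (Setoid)
open import Relation.Binary.Definitions using (tri<; tri≈; tri>)
open import Relation.Binary.PropositionalEquality as ≡ using (_≡_; _≢_)
import Relation.Binary.Reasoning.Setoid
open import Relation.Nullary using (Dec; yes; no; does; ¬_; _×-dec_)
open import Relation.Nullary.Decidable using (dec-true; dec-false; does-⇔)
open import Relation.Unary using (Pred; Decidable)
open import Algebra.Properties.Semiring.Sum ℕ.+-*-semiring
  using (sum-syntax; ∑-distrib-+; ∑-comm; *-distribˡ-sum; *-distribʳ-sum; sum-cong-≗)

open import Defs

module IntegerCoefficients {c ℓ} (R : CommutativeRing c ℓ) where
  open CommutativeRing R
  open import Algebra.Properties.Ring ring using (-‿distribˡ-*; -‿distribʳ-*)
  open import Algebra.Properties.AbelianGroup +-abelianGroup using (⁻¹-∙-comm)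
  open import Algebra.Properties.Group +-group using (ε⁻¹≈ε; ⁻¹-involutive)
  -- The optimised multiple makes ⟦ + 0 ⟧ℤ and ⟦ + 1 ⟧ℤ definitionally 0# and 1#,
  -- so that the solver's constants agree with the ring's.
  open import Algebra.Properties.Semiring.Mult.TCOptimised semiring using (1+×; ×-homo-+; ×1-homo-*) renaming (_×_ to _×ₙ_)
  open import Algebra.Solver.CommutativeMonoid +-commutativeMonoid using (solve; _⊕_; _⊜_)
  open import Relation.Binary.Reasoning.Setoid setoid

  ⟦_⟧ℤ : ℤ → Carrier
  ⟦ + n ⟧ℤ    = n ×ₙ 1#
  ⟦ -[1+ n ] ⟧ℤ = - (suc n ×ₙ 1#)

  ⟦⊖⟧ : ∀ m n → ⟦ m ℤ.⊖ n ⟧ℤ ≈ m ×ₙ 1# - n ×ₙ 1#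
  ⟦⊖⟧ zero    zero    = sym (trans (+-identityˡ _) ε⁻¹≈ε)
  ⟦⊖⟧ zero    (suc n) = sym (+-identityˡ _)
  ⟦⊖⟧ (suc m) zero    = sym (trans (+-congˡ ε⁻¹≈ε) (+-identityʳ _))
  ⟦⊖⟧ (suc m) (suc n) = begin
    ⟦ suc m ℤ.⊖ suc n ⟧ℤ              ≡⟨ ≡.cong ⟦_⟧ℤ (ℤ.[1+m]⊖[1+n]≡m⊖n m n) ⟩
    ⟦ m ℤ.⊖ n ⟧ℤ                      ≈⟨ ⟦⊖⟧ m n ⟩
    a - b                             ≈⟨ +-identityˡ _ ⟨
    0# + (a - b)                      ≈⟨ +-congʳ (-‿inverseʳ 1#) ⟨
    (1# - 1#) + (a - b)               ≈⟨ solve 4 (λ o a o' b → (o ⊕ o') ⊕ (a ⊕ b) ⊜ (o ⊕ a) ⊕ (o' ⊕ b)) refl 1# a (- 1#) (- b) ⟩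
    (1# + a) + (- 1# - b)             ≈⟨ +-congˡ (⁻¹-∙-comm 1# b) ⟩
    (1# + a) - (1# + b)               ≈⟨ +-cong (1+× m 1#) (-‿cong (1+× n 1#)) ⟨
    suc m ×ₙ 1# - suc n ×ₙ 1#         ∎
    where
    a = m ×ₙ 1#
    b = n ×ₙ 1#

  ⟦-⟧ : ∀ i → ⟦ ℤ.- i ⟧ℤ ≈ - ⟦ i ⟧ℤ
  ⟦-⟧ (+ zero)   = sym ε⁻¹≈ε
  ⟦-⟧ (+ suc n)  = refl
  ⟦-⟧ -[1+ n ]   = sym (⁻¹-involutive _)

  ⟦+⟧ : ∀ i j → ⟦ i ℤ.+ j ⟧ℤ ≈ ⟦ i ⟧ℤ + ⟦ j ⟧ℤ
  ⟦+⟧ (+ m)    (+ n)    = ×-homo-+ 1# m n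
  ⟦+⟧ (+ m)    -[1+ n ] = ⟦⊖⟧ m (suc n)
  ⟦+⟧ -[1+ m ] (+ n)    = trans (⟦⊖⟧ n (suc m)) (+-comm _ _)
  ⟦+⟧ -[1+ m ] -[1+ n ] = begin
    - (suc (suc (m ℕ.+ n)) ×ₙ 1#)       ≡⟨ ≡.cong (λ k → - (suc k ×ₙ 1#)) (ℕ.+-suc m n) ⟨
    - ((suc m ℕ.+ suc n) ×ₙ 1#)         ≈⟨ -‿cong (×-homo-+ 1# (suc m) (suc n)) ⟩
    - (suc m ×ₙ 1# + suc n ×ₙ 1#)        ≈⟨ ⁻¹-∙-comm _ _ ⟨
    - (suc m ×ₙ 1#) - (suc n ×ₙ 1#)      ∎

  ⟦+*⟧ : ∀ m j → ⟦ + m ℤ.* j ⟧ℤ ≈ m ×ₙ 1# * ⟦ j ⟧ℤ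
  ⟦+*⟧ m (+ n) = trans (reflexive (≡.cong ⟦_⟧ℤ (≡.sym (ℤ.pos-* m n)))) (×1-homo-* m n)
  ⟦+*⟧ m -[1+ n ] = begin
    ⟦ + m ℤ.* ℤ.- + suc n ⟧ℤ    ≡⟨ ≡.cong ⟦_⟧ℤ (ℤ.neg-distribʳ-* (+ m) (+ suc n)) ⟨
    ⟦ ℤ.- (+ m ℤ.* + suc n) ⟧ℤ  ≈⟨ ⟦-⟧ (+ m ℤ.* + suc n) ⟩
    - ⟦ + m ℤ.* + suc n ⟧ℤ      ≈⟨ -‿cong (⟦+*⟧ m (+ suc n)) ⟩
    - (m ×ₙ 1# * suc n ×ₙ 1#)     ≈⟨ -‿distribʳ-* _ _ ⟩
    m ×ₙ 1# * - (suc n ×ₙ 1#)     ∎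

  ⟦*⟧ : ∀ i j → ⟦ i ℤ.* j ⟧ℤ ≈ ⟦ i ⟧ℤ * ⟦ j ⟧ℤ
  ⟦*⟧ (+ m)    j = ⟦+*⟧ m j
  ⟦*⟧ -[1+ m ] j = begin
    ⟦ ℤ.- + suc m ℤ.* j ⟧ℤ      ≡⟨ ≡.cong ⟦_⟧ℤ (ℤ.neg-distribˡ-* (+ suc m) j) ⟨
    ⟦ ℤ.- (+ suc m ℤ.* j) ⟧ℤ    ≈⟨ ⟦-⟧ (+ suc m ℤ.* j) ⟩
    - ⟦ + suc m ℤ.* j ⟧ℤ        ≈⟨ -‿cong (⟦+*⟧ (suc m) j) ⟩
    - (suc m ×ₙ 1# * ⟦ j ⟧ℤ)     ≈⟨ -‿distribˡ-* _ _ ⟩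
    - (suc m ×ₙ 1#) * ⟦ j ⟧ℤ     ∎

  homomorphism : ℤ.+-*-rawRing ACR.-Raw-AlmostCommutative⟶ ACR.fromCommutativeRing R
  homomorphism = record
    { ⟦_⟧    = ⟦_⟧ℤ
    ; +-homo = ⟦+⟧
    ; *-homo = ⟦*⟧
    ; -‿homo = ⟦-⟧
    ; 0-homo = refl
    ; 1-homo = refl
    }

  ≡⇒⟦≈⟧ : ∀ i j → Maybe (⟦ i ⟧ℤ ≈ ⟦ j ⟧ℤ)
  ≡⇒⟦≈⟧ i j with i ℤ.≟ j
  ... | yes ≡.refl = just refl
  ... | no _       = nothing

  open import Algebra.Solver.Ring ℤ.+-*-rawRing (ACR.fromCommutativeRing R) homomorphism ≡⇒⟦≈⟧ public

𝟙 : Bool → ℕ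
𝟙 true  = 1
𝟙 false = 0

𝟙-∧ : ∀ a b → 𝟙 (a ∧ b) ≡ 𝟙 a ℕ.* 𝟙 b
𝟙-∧ true  b = ≡.sym (ℕ.+-identityʳ (𝟙 b))
𝟙-∧ false b = ≡.refl

𝟙-guarded : ∀ {p q r} {P : Set p} {Q : Set q} {R : Set r} (P? : Dec P) (Q? : Dec Q) (R? : Dec R) →
  (P → Q ⇔ R) → 𝟙 (does P?) ℕ.* 𝟙 (does Q?) ≡ 𝟙 (does P?) ℕ.* 𝟙 (does R?)
𝟙-guarded (yes p) Q? R? Q⇔R = ≡.cong (λ b → 1 ℕ.* 𝟙 b) (does-⇔ (Q⇔R p) Q? R?)
𝟙-guarded (no _)  Q? R? Q⇔R = ≡.refl

𝟙-union : ∀ a b → 𝟙 ((a ∨ b) ∧ not (a ∧ b)) ℕ.+ 2 ℕ.* 𝟙 (a ∧ b) ≡ 𝟙 a ℕ.+ 𝟙 b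
𝟙-union true  true  = ≡.refl
𝟙-union true  false = ≡.refl
𝟙-union false true  = ≡.refl
𝟙-union false false = ≡.refl

sum-const : ∀ n k → ∑[ i < n ] k ≡ n ℕ.* k
sum-const zero    k = ≡.refl
sum-const (suc n) k = ≡.cong (k ℕ.+_) (sum-const n k)

sum-point : ∀ {n} (g : Fin n → ℕ) j → (∀ i → i ≢ j → g i ≡ 0) → ∑[ i < n ] g i ≡ g j
sum-point {suc n} g Fin.zero    g≡0 = begin
  g Fin.zero ℕ.+ ∑[ i < n ] g (Fin.suc i)  ≡⟨ ≡.cong (g Fin.zero ℕ.+_) (≡.trans (sum-cong-≗ λ i → g≡0 (Fin.suc i) λ ()) (sum-const n 0)) ⟩
  g Fin.zero ℕ.+ n ℕ.* 0                    ≡⟨ ≡.cong (g Fin.zero ℕ.+_) (ℕ.*-zeroʳ n) ⟩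
  g Fin.zero ℕ.+ 0                          ≡⟨ ℕ.+-identityʳ _ ⟩
  g Fin.zero                                ∎
  where open ≡.≡-Reasoning
sum-point {suc n} g (Fin.suc j) g≡0 =
  ≡.cong₂ ℕ._+_ (g≡0 Fin.zero λ ()) (sum-point (λ i → g (Fin.suc i)) j λ i i≢j → g≡0 (Fin.suc i) (i≢j ∘ Fin.suc-injective))

𝟙-<-pair : ∀ {n} {i j : Fin n} → i ≢ j → 𝟙 (does (i Fin.<? j)) ℕ.+ 𝟙 (does (j Fin.<? i)) ≡ 1
𝟙-<-pair {i = i} {j} i≢j with Fin.<-cmp i j
... | tri< i<j _ j≮i = ≡.cong₂ (λ a b → 𝟙 a ℕ.+ 𝟙 b) (dec-true (i Fin.<? j) i<j) (dec-false (j Fin.<? i) j≮i)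
... | tri≈ _ i≡j _   = ⊥-elim (i≢j i≡j)
... | tri> i≮j _ j<i = ≡.cong₂ (λ a b → 𝟙 a ℕ.+ 𝟙 b) (dec-false (i Fin.<? j) i≮j) (dec-true (j Fin.<? i) j<i)

m+m%2≡0 : ∀ m → (m ℕ.+ m) ℕ.% 2 ≡ 0
m+m%2≡0 m = ≡.trans (≡.cong (λ k → (m ℕ.+ k) ℕ.% 2) (≡.sym (ℕ.+-identityʳ m)))
                    (≡.trans (≡.cong (ℕ._% 2) (ℕ.*-comm 2 m)) (ℕ.m*n%n≡0 m 2))

module _ {a} {A : Set a} where

  length-filter : ∀ (P : A → Bool) xs → length (filter (λ x → P x Bool.≟ true) xs) ≡ sum (map (λ x → 𝟙 (P x)) xs)
  length-filter P []       = ≡.refl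
  length-filter P (x ∷ xs) with P x
  ... | true  = ≡.cong suc (length-filter P xs)
  ... | false = length-filter P xs

  length≡sum : ∀ (xs : List A) → length xs ≡ sum (map (λ _ → 1) xs)
  length≡sum []       = ≡.refl
  length≡sum (x ∷ xs) = ≡.cong suc (length≡sum xs)

  sum-map-cong : ∀ {f g : A → ℕ} → (∀ x → f x ≡ g x) → ∀ xs → sum (map f xs) ≡ sum (map g xs)
  sum-map-cong f≡g xs = ≡.cong sum (List.map-cong f≡g xs)

  sum-map-tabulate : ∀ {n} (f : A → ℕ) (g : Fin n → A) → sum (map f (tabulate g)) ≡ ∑[ i < n ] f (g i)
  sum-map-tabulate {zero}  f g = ≡.refl
  sum-map-tabulate {suc n} f g = ≡.cong (f (g Fin.zero) ℕ.+_) (sum-map-tabulate f (λ i → g (Fin.suc i)))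

  module _ {b} {B : Set b} where

    sum-map-map : ∀ (f : B → ℕ) (g : A → B) xs → sum (map f (map g xs)) ≡ sum (map (λ x → f (g x)) xs)
    sum-map-map f g xs = ≡.cong sum (≡.sym (List.map-∘ xs))

    sum-map-concatMap : ∀ (f : B → ℕ) (g : A → List B) xs →
      sum (map f (concatMap g xs)) ≡ sum (map (λ x → sum (map f (g x))) xs)
    sum-map-concatMap f g []       = ≡.refl
    sum-map-concatMap f g (x ∷ xs) = begin
      sum (map f (g x ++ concatMap g xs))                 ≡⟨ ≡.cong sum (List.map-++ f (g x) _) ⟩
      sum (map f (g x) ++ map f (concatMap g xs))         ≡⟨ sum-++ (map f (g x)) _ ⟩
      sum (map f (g x)) ℕ.+ sum (map f (concatMap g xs))  ≡⟨ ≡.cong (_ ℕ.+_) (sum-map-concatMap f g xs) ⟩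
      sum (map f (g x)) ℕ.+ sum (map (λ x → sum (map f (g x))) xs) ∎
      where open ≡.≡-Reasoning

module EnumeratedSum {c ℓ} (A : Setoid c ℓ) (n : ℕ)
  (enum : Fin n → Setoid.Carrier A) (enum-inj : ∀ i j → Setoid._≈_ A (enum i) (enum j) → i ≡ j)
  (index : Setoid.Carrier A → Fin n) (enum-surj : ∀ x → Setoid._≈_ A (enum (index x)) x) where

  open Setoid A

  open ≡.≡-Reasoning

  index-cong : ∀ {x y} → x ≈ y → index x ≡ index y
  index-cong {x} {y} x≈y = enum-inj _ _ (trans (enum-surj x) (trans x≈y (sym (enum-surj y))))

  -- Opaque so that unification treats ∑ f as rigid in f.
  opaque
    ∑ : (Carrier → ℕ) → ℕ
    ∑ f = ∑[ i < n ] f (enum i)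

    sum-map-allFin : ∀ (f : Carrier → ℕ) → sum (map (λ i → f (enum i)) (allFin n)) ≡ ∑ f
    sum-map-allFin f = sum-map-tabulate (λ i → f (enum i)) id

    ∑-cong : ∀ {f g : Carrier → ℕ} → (∀ x → f x ≡ g x) → ∑ f ≡ ∑ g
    ∑-cong f≡g = sum-cong-≗ (λ i → f≡g (enum i))

    ∑-+ : ∀ (f g : Carrier → ℕ) → ∑ (λ x → f x ℕ.+ g x) ≡ ∑ f ℕ.+ ∑ g
    ∑-+ f g = ∑-distrib-+ (λ i → f (enum i)) (λ i → g (enum i))

    ∑-*ˡ : ∀ k (f : Carrier → ℕ) → ∑ (λ x → k ℕ.* f x) ≡ k ℕ.* ∑ f
    ∑-*ˡ k f = ≡.sym (*-distribˡ-sum k (λ i → f (enum i)))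

    ∑-*ʳ : ∀ k (f : Carrier → ℕ) → ∑ (λ x → f x ℕ.* k) ≡ ∑ f ℕ.* k
    ∑-*ʳ k f = ≡.sym (*-distribʳ-sum k (λ i → f (enum i)))

    ∑-const : ∀ k → ∑ (λ _ → k) ≡ n ℕ.* k
    ∑-const k = sum-const n k

    ∑-swap : ∀ (f : Carrier → Carrier → ℕ) → ∑ (λ x → ∑ (λ y → f x y)) ≡ ∑ (λ y → ∑ (λ x → f x y))
    ∑-swap f = ∑-comm (λ i j → f (enum i) (enum j))

    ∑-unique : ∀ {p} {P : Pred Carrier p} (P? : Decidable P) {x₀} (f : Carrier → ℕ) →
      (∀ {x} → P x → x ≈ x₀) → (∀ {x} → x ≈ x₀ → P x) → (∀ {x} → x ≈ x₀ → f x ≡ f x₀) →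
      ∑ (λ x → f x ℕ.* 𝟙 (does (P? x))) ≡ f x₀
    ∑-unique {P = P} P? {x₀} f P⇒≈ ≈⇒P f-resp = begin
      ∑ (λ x → f x ℕ.* 𝟙 (does (P? x)))
        ≡⟨ sum-point _ (index x₀) off-x₀ ⟩
      f x₀′ ℕ.* 𝟙 (does (P? x₀′))
        ≡⟨ ≡.cong₂ (λ a b → a ℕ.* 𝟙 b) (f-resp x₀′≈x₀) (dec-true (P? x₀′) (≈⇒P x₀′≈x₀)) ⟩
      f x₀ ℕ.* 1
        ≡⟨ ℕ.*-identityʳ (f x₀) ⟩
      f x₀ ∎
      where
      x₀′ : Carrier
      x₀′ = enum (index x₀)
      x₀′≈x₀ : x₀′ ≈ x₀
      x₀′≈x₀ = enum-surj x₀
      off-x₀ : ∀ i → i ≢ index x₀ → f (enum i) ℕ.* 𝟙 (does (P? (enum i))) ≡ 0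
      off-x₀ i i≢ = begin
        f (enum i) ℕ.* 𝟙 (does (P? (enum i))) ≡⟨ ≡.cong (λ b → f (enum i) ℕ.* 𝟙 b) (dec-false (P? (enum i)) ¬P) ⟩
        f (enum i) ℕ.* 0                      ≡⟨ ℕ.*-zeroʳ (f (enum i)) ⟩
        0                                     ∎
        where
        ¬P : ¬ P (enum i)
        ¬P Pi = i≢ (enum-inj _ _ (trans (P⇒≈ Pi) (sym x₀′≈x₀)))

  ∑-𝟙-unique : ∀ {p} {P : Pred Carrier p} (P? : Decidable P) {x₀} →
    (∀ {x} → P x → x ≈ x₀) → (∀ {x} → x ≈ x₀ → P x) → ∑ (λ x → 𝟙 (does (P? x))) ≡ 1
  ∑-𝟙-unique P? P⇒≈ ≈⇒P = ≡.trans (∑-cong λ x → ≡.sym (ℕ.*-identityˡ (𝟙 (does (P? x)))))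
    (∑-unique P? (λ _ → 1) P⇒≈ ≈⇒P (λ _ → ≡.refl))

CharacteristicNotTwo : ∀ {c ℓ q} → FiniteField c ℓ q → Set ℓ
CharacteristicNotTwo F = ¬ (1# + 1# ≈ 0#)
  where open FiniteField F

module FiniteFieldCounting {c ℓ q} (F : FiniteField c ℓ q) where

  open FiniteField F
  open EnumeratedSum setoid q enum enum-inj index enum-surj public
  open IntegerCoefficients commutativeRing using (solve; _:=_; _:+_; _:*_; :-_; _:-_; con)
  module ≈-Reasoning = Relation.Binary.Reasoning.Setoid setoid

  δ : Carrier → Carrier → ℕ
  δ x y = 𝟙 (does (x ≟ y))

  ≈-⇔ : ∀ {x x′ y y′} → x ≈ x′ → y ≈ y′ → (x ≈ y) ⇔ (x′ ≈ y′)
  ≈-⇔ x≈x′ y≈y′ = mk⇔ (λ x≈y → trans (sym x≈x′) (trans x≈y y≈y′)) (λ x′≈y′ → trans x≈x′ (trans x′≈y′ (sym y≈y′)))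

  +-cancel-⇔ : ∀ {x y k u v} → x ≈ k + u → y ≈ k + v → (x ≈ y) ⇔ (u ≈ v)
  +-cancel-⇔ {k = k} {u} {v} x≈k+u y≈k+v = mk⇔
    (λ x≈y → +-cancelˡ k u v (trans (sym x≈k+u) (trans x≈y y≈k+v)))
    (λ u≈v → trans x≈k+u (trans (+-congˡ u≈v) (sym y≈k+v)))
    where open import Algebra.Properties.Group +-group using () renaming (∙-cancelˡ to +-cancelˡ)

  δ-cong : ∀ {x x′ y y′} → x ≈ x′ → y ≈ y′ → δ x y ≡ δ x′ y′
  δ-cong x≈x′ y≈y′ = ≡.cong 𝟙 (does-⇔ (≈-⇔ x≈x′ y≈y′) (_ ≟ _) (_ ≟ _))

  δ-sym : ∀ x y → δ x y ≡ δ y x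
  δ-sym x y = ≡.cong 𝟙 (does-⇔ (mk⇔ sym sym) (x ≟ y) (y ≟ x))

  x≈0⇒-x≈0 : ∀ {x} → x ≈ 0# → - x ≈ 0#
  x≈0⇒-x≈0 x≈0 = trans (-‿cong x≈0) ε⁻¹≈ε
    where open import Algebra.Properties.Group +-group using (ε⁻¹≈ε)

  -x≈0⇒x≈0 : ∀ {x} → - x ≈ 0# → x ≈ 0#
  -x≈0⇒x≈0 -x≈0 = trans (sym (⁻¹-involutive _)) (x≈0⇒-x≈0 -x≈0)
    where open import Algebra.Properties.Group +-group using (⁻¹-involutive)

  ∑-δ : ∀ (f : Carrier → ℕ) a → (∀ {x} → x ≈ a → f x ≡ f a) → ∑ (λ x → f x ℕ.* δ x a) ≡ f a
  ∑-δ f a f-resp = ∑-unique (_≟ a) f id id f-resp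

  1≉0 : ¬ 1# ≈ 0#
  1≉0 1≈0 = 0≉1 (sym 1≈0)

  *-cancel-≈0 : ∀ {a x} → ¬ a ≈ 0# → a * x ≈ 0# → x ≈ 0#
  *-cancel-≈0 {a} {x} a≉0 ax≈0 = begin
    x               ≈⟨ *-identityʳ x ⟨
    x * 1#          ≈⟨ *-congˡ (proj₂ (inv a a≉0)) ⟨
    x * (a * a⁻¹)   ≈⟨ solve 3 (λ a x i → x :* (a :* i) := i :* (a :* x)) refl a x a⁻¹ ⟩
    a⁻¹ * (a * x)   ≈⟨ *-congˡ ax≈0 ⟩
    a⁻¹ * 0#        ≈⟨ zeroʳ a⁻¹ ⟩
    0#              ∎
    where
    open ≈-Reasoning
    a⁻¹ = proj₁ (inv a a≉0)

  ∑-δ-point : ∀ a → ∑ (λ x → δ x a) ≡ 1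
  ∑-δ-point a = ∑-𝟙-unique (_≟ a) id id

  ∑-δ-affine : ∀ {a} b u → ¬ a ≈ 0# → ∑ (λ x → δ (a * x + b) u) ≡ 1
  ∑-δ-affine {a} b u a≉0 = ∑-𝟙-unique (λ x → (a * x + b) ≟ u) P⇒≈ ≈⇒P
    where
    open ≈-Reasoning
    a⁻¹ = proj₁ (inv a a≉0)
    a*a⁻¹≈1 = proj₂ (inv a a≉0)
    x₀ = (u - b) * a⁻¹
    P⇒≈ : ∀ {x} → a * x + b ≈ u → x ≈ x₀
    P⇒≈ {x} ax+b≈u = begin
      x                       ≈⟨ *-identityʳ x ⟨
      x * 1#                  ≈⟨ *-congˡ a*a⁻¹≈1 ⟨
      x * (a * a⁻¹)           ≈⟨ solve 4 (λ a b x i → x :* (a :* i) := (a :* x :+ b :- b) :* i) refl a b x a⁻¹ ⟩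
      (a * x + b - b) * a⁻¹   ≈⟨ *-congʳ (+-congʳ ax+b≈u) ⟩
      x₀                      ∎
    ≈⇒P : ∀ {x} → x ≈ x₀ → a * x + b ≈ u
    ≈⇒P {x} x≈x₀ = begin
      a * x + b               ≈⟨ +-congʳ (*-congˡ x≈x₀) ⟩
      a * x₀ + b              ≈⟨ solve 4 (λ a b u i → a :* ((u :- b) :* i) :+ b := (u :- b) :* (a :* i) :+ b) refl a b u a⁻¹ ⟩
      (u - b) * (a * a⁻¹) + b ≈⟨ +-congʳ (*-congˡ a*a⁻¹≈1) ⟩
      (u - b) * 1# + b        ≈⟨ solve 2 (λ u b → (u :- b) :* con (ℤ.+ 1) :+ b := u) refl u b ⟩
      u                       ∎

  ∑-δ-shift : ∀ a u → ∑ (λ x → δ (a + x) u) ≡ 1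
  ∑-δ-shift a u = ≡.trans (∑-cong λ x → δ-cong (trans (+-comm a x) (+-congʳ (sym (*-identityˡ x)))) refl)
                          (∑-δ-affine a u 1≉0)

  ∑-translate : ∀ (f : Carrier → ℕ) → (∀ {x y} → x ≈ y → f x ≡ f y) → ∀ t → ∑ (λ x → f (x + t)) ≡ ∑ f
  ∑-translate f f-resp t = begin
    ∑ (λ x → f (x + t))                          ≡⟨ ∑-cong (λ x → ∑-δ f (x + t) f-resp) ⟨
    ∑ (λ x → ∑ (λ y → f y ℕ.* δ y (x + t)))      ≡⟨ ∑-swap (λ x y → f y ℕ.* δ y (x + t)) ⟩
    ∑ (λ y → ∑ (λ x → f y ℕ.* δ y (x + t)))      ≡⟨ ∑-cong (λ y → ∑-*ˡ (f y) (λ x → δ y (x + t))) ⟩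
    ∑ (λ y → f y ℕ.* ∑ (λ x → δ y (x + t)))      ≡⟨ ∑-cong (λ y → ≡.cong (f y ℕ.*_) (solutions y)) ⟩
    ∑ (λ y → f y ℕ.* 1)                          ≡⟨ ∑-cong (λ y → ℕ.*-identityʳ (f y)) ⟩
    ∑ f                                          ∎
    where
    open ≡.≡-Reasoning
    solutions : ∀ y → ∑ (λ x → δ y (x + t)) ≡ 1
    solutions y = ≡.trans (∑-cong λ x → ≡.trans (δ-sym y (x + t)) (δ-cong (+-comm x t) refl)) (∑-δ-shift t y)

  index-injective : ∀ {x y} → index x ≡ index y → x ≈ y
  index-injective {x} {y} eq = trans (sym (enum-surj x)) (trans (reflexive (≡.cong enum eq)) (enum-surj y))

  odd-order⇒1+1≉0 : q ℕ.% 2 ≡ 1 → CharacteristicNotTwo F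
  odd-order⇒1+1≉0 q-odd 1+1≈0 = ℕ.1+n≢0 (≡.trans (≡.sym q-odd) (≡.trans (≡.cong (ℕ._% 2) q≡∑h+∑h) (m+m%2≡0 (∑ h))))
    where
    open ≡.≡-Reasoning
    -- If 1 + 1 = 0, translation by 1 is a fixed-point-free involution, so h x + h (x + 1) = 1
    -- and q = 2 ∑ h.
    h : Carrier → ℕ
    h x = 𝟙 (does (index x Fin.<? index (x + 1#)))
    h-resp : ∀ {x y} → x ≈ y → h x ≡ h y
    h-resp x≈y = ≡.cong₂ (λ i j → 𝟙 (does (i Fin.<? j))) (index-cong x≈y) (index-cong (+-congʳ x≈y))
    x+1+1≈x : ∀ x → x + 1# + 1# ≈ x
    x+1+1≈x x = trans (+-assoc x 1# 1#) (trans (+-congˡ 1+1≈0) (+-identityʳ x))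
    x≉x+1 : ∀ x → ¬ x ≈ x + 1#
    x≉x+1 x x≈x+1 = 1≉0 (identityʳ-unique x 1# (sym x≈x+1))
      where open import Algebra.Properties.Group +-group using (identityʳ-unique)
    h-pair : ∀ x → h x ℕ.+ h (x + 1#) ≡ 1
    h-pair x = begin
      h x ℕ.+ h (x + 1#)                    ≡⟨ ≡.cong (λ i → h x ℕ.+ 𝟙 (does (index (x + 1#) Fin.<? i))) (index-cong (x+1+1≈x x)) ⟩
      h x ℕ.+ 𝟙 (does (index (x + 1#) Fin.<? index x)) ≡⟨ 𝟙-<-pair (λ eq → x≉x+1 x (index-injective eq)) ⟩
      1                                                ∎
    q≡∑h+∑h : q ≡ ∑ h ℕ.+ ∑ h
    q≡∑h+∑h = begin
      q                                 ≡⟨ ℕ.*-identityʳ q ⟨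
      q ℕ.* 1                           ≡⟨ ∑-const 1 ⟨
      ∑ (λ _ → 1)                       ≡⟨ ∑-cong h-pair ⟨
      ∑ (λ x → h x ℕ.+ h (x + 1#))      ≡⟨ ∑-+ h (λ x → h (x + 1#)) ⟩
      ∑ h ℕ.+ ∑ (λ x → h (x + 1#))      ≡⟨ ≡.cong (∑ h ℕ.+_) (∑-translate h h-resp 1#) ⟩
      ∑ h ℕ.+ ∑ h                       ∎

pdsCoefficient : ℕ → ℕ → ℕ → Bool → Bool → ℕ
pdsCoefficient k _  _ true  _     = k
pdsCoefficient _ λ′ _ false true  = λ′
pdsCoefficient _ _  μ false false = μ

+2⇒∸2 : ∀ {m n} → m ℕ.+ 2 ≡ n → m ≡ n ℕ.∸ 2
+2⇒∸2 {m} eq = ≡.trans (≡.sym (ℕ.m+n∸n≡m m 2)) (≡.cong (ℕ._∸ 2) eq)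

pdsCoefficient-from-count : ∀ q n (isE inS : Bool) → (isE ≡ true → inS ≡ false) →
  n ℕ.+ 4 ℕ.* 𝟙 inS ℕ.+ 4 ℕ.* 𝟙 isE ≡ q ℕ.+ q ℕ.* (q ℕ.* 𝟙 isE) ℕ.+ 2 →
  n ≡ pdsCoefficient (q ℕ.* q ℕ.+ q ℕ.∸ 2) (q ℕ.∸ 2) (q ℕ.+ 2) isE inS
pdsCoefficient-from-count q n true  true  e∉S _ with () ← e∉S ≡.refl
pdsCoefficient-from-count q n true  false _ eq =
  +2⇒∸2 (ℕ.+-cancelʳ-≡ 2 (n ℕ.+ 2) (q ℕ.* q ℕ.+ q) (≡.trans (l n) (≡.trans eq (r q))))
  where
  l : ∀ n → n ℕ.+ 2 ℕ.+ 2 ≡ n ℕ.+ 0 ℕ.+ 4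
  l = solve-∀
  r : ∀ q → q ℕ.+ q ℕ.* (q ℕ.* 1) ℕ.+ 2 ≡ q ℕ.* q ℕ.+ q ℕ.+ 2
  r = solve-∀
pdsCoefficient-from-count q n false true  _ eq =
  +2⇒∸2 (ℕ.+-cancelʳ-≡ 2 (n ℕ.+ 2) q (≡.trans (l n) (≡.trans eq (r q))))
  where
  l : ∀ n → n ℕ.+ 2 ℕ.+ 2 ≡ n ℕ.+ 4 ℕ.+ 0
  l = solve-∀
  r : ∀ q → q ℕ.+ q ℕ.* (q ℕ.* 0) ℕ.+ 2 ≡ q ℕ.+ 2
  r = solve-∀
pdsCoefficient-from-count q n false false _ eq = ≡.trans (l n) (≡.trans eq (r q))
  where
  l : ∀ n → n ≡ n ℕ.+ 0 ℕ.+ 0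
  l = solve-∀
  r : ∀ q → q ℕ.+ q ℕ.* (q ℕ.* 0) ℕ.+ 2 ≡ q ℕ.+ 2
  r = solve-∀

module HeisenbergCounting {c ℓ q} (F : FiniteField c ℓ q) where

  open FiniteField F
  open FiniteFieldCounting F
  open Heisenberg F
  open IntegerCoefficients commutativeRing using (solve; _:=_; _:+_; _:*_; :-_; _:-_; con)
  open import Algebra.Properties.Group +-group using (inverseʳ-unique)
  open ≡.≡-Reasoning

  ≈H-refl : ∀ {s} → s ≈H s
  ≈H-refl = refl , refl , refl

  ≈H-sym : ∀ {s t} → s ≈H t → t ≈H s
  ≈H-sym (x≈ , y≈ , z≈) = sym x≈ , sym y≈ , sym z≈

  ≈H-trans : ∀ {s t u} → s ≈H t → t ≈H u → s ≈H u
  ≈H-trans (x≈ , y≈ , z≈) (x≈′ , y≈′ , z≈′) = trans x≈ x≈′ , trans y≈ y≈′ , trans z≈ z≈′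

  _≈H?_ : ∀ s t → Dec (s ≈H t)
  (x , y , z) ≈H? (x′ , y′ , z′) = x ≟ x′ ×-dec (y ≟ y′ ×-dec z ≟ z′)

  ≟H≡does : ∀ s t → s ≟H t ≡ does (s ≈H? t)
  ≟H≡does (x , y , z) (x′ , y′ , z′) with x ≟ x′ | y ≟ y′ | z ≟ z′
  ... | yes _ | yes _ | yes _ = ≡.refl
  ... | yes _ | yes _ | no _  = ≡.refl
  ... | yes _ | no _  | _     = ≡.refl
  ... | no _  | _     | _     = ≡.refl

  ≟H-⇔ : ∀ {s t s′ t′} → (s ≈H t → s′ ≈H t′) → (s′ ≈H t′ → s ≈H t) → s ≟H t ≡ s′ ≟H t′
  ≟H-⇔ {s} {t} {s′} {t′} to from = begin
    s ≟H t              ≡⟨ ≟H≡does s t ⟩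
    does (s ≈H? t)      ≡⟨ does-⇔ (mk⇔ to from) (s ≈H? t) (s′ ≈H? t′) ⟩
    does (s′ ≈H? t′)    ≡⟨ ≟H≡does s′ t′ ⟨
    s′ ≟H t′            ∎

  δH : H → H → ℕ
  δH s t = 𝟙 (s ≟H t)

  δH-split : ∀ x y z a b c → δH (x , y , z) (a , b , c) ≡ δ x a ℕ.* (δ y b ℕ.* δ z c)
  δH-split x y z a b c = begin
    δH (x , y , z) (a , b , c)                              ≡⟨ ≡.cong 𝟙 (≟H≡does (x , y , z) (a , b , c)) ⟩
    𝟙 (does (x ≟ a) ∧ (does (y ≟ b) ∧ does (z ≟ c)))        ≡⟨ 𝟙-∧ (does (x ≟ a)) _ ⟩
    δ x a ℕ.* 𝟙 (does (y ≟ b) ∧ does (z ≟ c))               ≡⟨ ≡.cong (δ x a ℕ.*_) (𝟙-∧ (does (y ≟ b)) _) ⟩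
    δ x a ℕ.* (δ y b ℕ.* δ z c)                             ∎

  ·-congˡ : ∀ h {s t} → s ≈H t → (h · s) ≈H (h · t)
  ·-congˡ (a , b , c) (x≈ , y≈ , z≈) = +-congˡ x≈ , +-congˡ y≈ , +-cong (+-congˡ z≈) (*-congˡ y≈)

  ·-identityʳ : ∀ h → (h · e) ≈H h
  ·-identityʳ (a , b , c) = +-identityʳ a , +-identityʳ b ,
    solve 2 (λ a c → c :+ con (ℤ.+ 0) :+ a :* con (ℤ.+ 0) := c) refl a c

  ·⁻¹≈⇒ : ∀ s t g → (s · (t ⁻¹)) ≈H g → t ≈H ((g ⁻¹) · s)
  ·⁻¹≈⇒ (x , y , z) (x′ , y′ , z′) (a , b , c) (x≈ , y≈ , z≈) =
    trans (solve 2 (λ x x′ → x′ := :- (x :- x′) :+ x) refl x x′) (+-congʳ (-‿cong x≈)) ,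
    trans (solve 2 (λ y y′ → y′ := :- (y :- y′) :+ y) refl y y′) (+-congʳ (-‿cong y≈)) ,
    trans (solve 6 (λ x y z x′ y′ z′ → z′ :=
                      :- (z :+ (:- z′ :+ x′ :* y′) :+ x :* (:- y′)) :+ (x :- x′) :* (y :- y′) :+ z :+ (:- (x :- x′)) :* y)
                   refl x y z x′ y′ z′)
          (+-cong (+-congʳ (+-cong (-‿cong z≈) (*-cong x≈ y≈))) (*-congʳ (-‿cong x≈)))

  ·⁻¹≈⇐ : ∀ s t g → t ≈H ((g ⁻¹) · s) → (s · (t ⁻¹)) ≈H g
  ·⁻¹≈⇐ (x , y , z) (x′ , y′ , z′) (a , b , c) (x′≈ , y′≈ , z′≈) =
    trans (+-congˡ (-‿cong x′≈)) (solve 2 (λ x a → x :- (:- a :+ x) := a) refl x a) ,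
    trans (+-congˡ (-‿cong y′≈)) (solve 2 (λ y b → y :- (:- b :+ y) := b) refl y b) ,
    trans (+-cong (+-congˡ (+-cong (-‿cong z′≈) (*-cong x′≈ y′≈))) (*-congˡ (-‿cong y′≈)))
          (solve 6 (λ x y z a b c →
                      z :+ (:- (:- c :+ a :* b :+ z :+ :- a :* y) :+ (:- a :+ x) :* (:- b :+ y)) :+ x :* (:- (:- b :+ y)) := c)
                   refl x y z a b c)

  ·≈e⇒ : ∀ h s → (h · s) ≈H e → s ≈H (h ⁻¹)
  ·≈e⇒ (a , b , c) (x , y , z) (x≈ , y≈ , z≈) =
    inverseʳ-unique a x x≈ ,
    inverseʳ-unique b y y≈ ,
    trans (solve 4 (λ a b c z → z := :- c :+ a :* b :+ (c :+ z :+ a :* (:- b))) refl a b c z)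
          (trans (+-congˡ (trans (+-congˡ (*-congˡ (sym (inverseʳ-unique b y y≈)))) z≈)) (+-identityʳ _))

  ·≈e⇐ : ∀ h s → s ≈H (h ⁻¹) → (h · s) ≈H e
  ·≈e⇐ (a , b , c) (x , y , z) (x≈ , y≈ , z≈) =
    trans (+-congˡ x≈) (-‿inverseʳ a) ,
    trans (+-congˡ y≈) (-‿inverseʳ b) ,
    trans (+-cong (+-congˡ z≈) (*-congˡ y≈)) (solve 3 (λ a b c → c :+ (:- c :+ a :* b) :+ a :* (:- b) := con (ℤ.+ 0)) refl a b c)

  ⁻¹≟e : ∀ g → (g ⁻¹) ≟H e ≡ g ≟H e
  ⁻¹≟e (x , y , z) = ≟H-⇔
    (λ (x≈ , y≈ , z≈) → -x≈0⇒x≈0 x≈ , -x≈0⇒x≈0 y≈ ,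
       trans (solve 3 (λ x y z → z := :- (:- z :+ x :* y) :+ x :* y) refl x y z)
             (trans (+-cong (-‿cong z≈) (*-congʳ (-x≈0⇒x≈0 x≈))) (solve 1 (λ y → :- con (ℤ.+ 0) :+ con (ℤ.+ 0) :* y := con (ℤ.+ 0)) refl y)))
    (λ (x≈ , y≈ , z≈) → x≈0⇒-x≈0 x≈ , x≈0⇒-x≈0 y≈ ,
       trans (+-cong (-‿cong z≈) (*-congʳ x≈)) (solve 1 (λ y → :- con (ℤ.+ 0) :+ con (ℤ.+ 0) :* y := con (ℤ.+ 0)) refl y))

  Σ3 : (H → ℕ) → ℕ
  Σ3 f = ∑ λ x → ∑ λ y → ∑ λ z → f (x , y , z)

  Σ3-cong : ∀ {f g : H → ℕ} → (∀ s → f s ≡ g s) → Σ3 f ≡ Σ3 g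
  Σ3-cong f≡g = ∑-cong λ x → ∑-cong λ y → ∑-cong λ z → f≡g (x , y , z)

  Σ3-+ : ∀ (f g : H → ℕ) → Σ3 (λ s → f s ℕ.+ g s) ≡ Σ3 f ℕ.+ Σ3 g
  Σ3-+ f g = ≡.trans (∑-cong λ x → ≡.trans (∑-cong λ y → ∑-+ _ _) (∑-+ _ _)) (∑-+ _ _)

  Σ3-*ˡ : ∀ k (f : H → ℕ) → Σ3 (λ s → k ℕ.* f s) ≡ k ℕ.* Σ3 f
  Σ3-*ˡ k f = ≡.trans (∑-cong λ x → ≡.trans (∑-cong λ y → ∑-*ˡ k _) (∑-*ˡ k _)) (∑-*ˡ k _)

  Σ3-product : ∀ (f g h : Carrier → ℕ) → Σ3 (λ (x , y , z) → f x ℕ.* (g y ℕ.* h z)) ≡ ∑ f ℕ.* (∑ g ℕ.* ∑ h)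
  Σ3-product f g h = begin
    ∑ (λ x → ∑ (λ y → ∑ (λ z → f x ℕ.* (g y ℕ.* h z))))
      ≡⟨ ∑-cong (λ x → ∑-cong λ y → ≡.trans (∑-*ˡ (f x) (λ z → g y ℕ.* h z)) (≡.cong (f x ℕ.*_) (∑-*ˡ (g y) h))) ⟩
    ∑ (λ x → ∑ (λ y → f x ℕ.* (g y ℕ.* ∑ h)))
      ≡⟨ ∑-cong (λ x → ≡.trans (∑-*ˡ (f x) (λ y → g y ℕ.* ∑ h)) (≡.cong (f x ℕ.*_) (∑-*ʳ (∑ h) g))) ⟩
    ∑ (λ x → f x ℕ.* (∑ g ℕ.* ∑ h))
      ≡⟨ ∑-*ʳ _ f ⟩
    ∑ f ℕ.* (∑ g ℕ.* ∑ h) ∎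

  Σ3-δH : ∀ (f : H → ℕ) → (∀ {s t} → s ≈H t → f s ≡ f t) → ∀ t → Σ3 (λ s → f s ℕ.* δH s t) ≡ f t
  Σ3-δH f f-resp (a , b , c) = begin
    Σ3 (λ s → f s ℕ.* δH s (a , b , c))
      ≡⟨ ∑-cong (λ x → ∑-cong λ y → ∑-cong λ z → ≡.trans (≡.cong (f (x , y , z) ℕ.*_) (δH-split x y z a b c))
                                                          (regroup (f (x , y , z)) (δ x a) (δ y b) (δ z c))) ⟩
    ∑ (λ x → ∑ (λ y → ∑ (λ z → f (x , y , z) ℕ.* δ z c ℕ.* δ y b ℕ.* δ x a)))
      ≡⟨ ∑-cong (λ x → ≡.trans (∑-cong λ y → ∑-*ʳ (δ x a) (λ z → f (x , y , z) ℕ.* δ z c ℕ.* δ y b))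
                         (≡.trans (∑-*ʳ (δ x a) (λ y → ∑ (λ z → f (x , y , z) ℕ.* δ z c ℕ.* δ y b)))
                          (≡.cong (ℕ._* δ x a) (∑-cong λ y → ∑-*ʳ (δ y b) (λ z → f (x , y , z) ℕ.* δ z c))))) ⟩
    ∑ (λ x → ∑ (λ y → ∑ (λ z → f (x , y , z) ℕ.* δ z c) ℕ.* δ y b) ℕ.* δ x a)
      ≡⟨ ∑-δ (λ x → ∑ (λ y → ∑ (λ z → f (x , y , z) ℕ.* δ z c) ℕ.* δ y b)) a
             (λ {x} x≈a → ∑-cong λ y → ≡.cong (ℕ._* δ y b) (∑-cong λ z →
                ≡.cong (ℕ._* δ z c) (f-resp {x , y , z} {a , y , z} (x≈a , refl , refl)))) ⟩
    ∑ (λ y → ∑ (λ z → f (a , y , z) ℕ.* δ z c) ℕ.* δ y b)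
      ≡⟨ ∑-δ (λ y → ∑ (λ z → f (a , y , z) ℕ.* δ z c)) b
             (λ {y} y≈b → ∑-cong λ z → ≡.cong (ℕ._* δ z c) (f-resp {a , y , z} {a , b , z} (refl , y≈b , refl))) ⟩
    ∑ (λ z → f (a , b , z) ℕ.* δ z c)
      ≡⟨ ∑-δ (λ z → f (a , b , z)) c (λ {z} z≈c → f-resp {a , b , z} {a , b , c} (refl , refl , z≈c)) ⟩
    f (a , b , c) ∎
    where
    regroup : ∀ w p r t → w ℕ.* (p ℕ.* (r ℕ.* t)) ≡ w ℕ.* t ℕ.* r ℕ.* p
    regroup = solve-∀

  sum-elems : ∀ (f : H → ℕ) → sum (map f elems) ≡ Σ3 f
  sum-elems f = begin
    sum (map f elems)
      ≡⟨ sum-map-concatMap f (λ i → concatMap (row i) (allFin q)) (allFin q) ⟩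
    sum (map (λ i → sum (map f (concatMap (row i) (allFin q)))) (allFin q))
      ≡⟨ sum-map-cong (λ i → sum-map-concatMap f (row i) (allFin q)) (allFin q) ⟩
    sum (map (λ i → sum (map (λ j → sum (map f (row i j))) (allFin q))) (allFin q))
      ≡⟨ sum-map-cong (λ i → sum-map-cong (λ j → ≡.trans (sum-map-map f _ (allFin q))
                                                   (sum-map-allFin (λ z → f (enum i , enum j , z)))) (allFin q)) (allFin q) ⟩
    sum (map (λ i → sum (map (λ j → ∑ (λ z → f (enum i , enum j , z))) (allFin q))) (allFin q))
      ≡⟨ sum-map-cong (λ i → sum-map-allFin (λ y → ∑ (λ z → f (enum i , y , z)))) (allFin q) ⟩
    sum (map (λ i → ∑ (λ y → ∑ (λ z → f (enum i , y , z)))) (allFin q))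
      ≡⟨ sum-map-allFin (λ x → ∑ (λ y → ∑ (λ z → f (x , y , z)))) ⟩
    Σ3 f ∎
    where
    row : Fin q → Fin q → List H
    row i j = map (λ k → (enum i , enum j , enum k)) (allFin q)

  length-elems : length elems ≡ q ℕ.^ 3
  length-elems = begin
    length elems                   ≡⟨ length≡sum elems ⟩
    sum (map (λ _ → 1) elems)      ≡⟨ sum-elems (λ _ → 1) ⟩
    ∑ (λ _ → ∑ (λ _ → ∑ λ _ → 1))  ≡⟨ ∑-cong (λ _ → ≡.trans (∑-cong λ _ → ∑-const 1) (∑-const (q ℕ.* 1))) ⟩
    ∑ (λ _ → q ℕ.* (q ℕ.* 1))      ≡⟨ ∑-const _ ⟩
    q ℕ.* (q ℕ.* (q ℕ.* 1))        ∎

  _⋆_ : (H → ℕ) → (H → ℕ) → H → ℕ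
  (f ⋆ g) h = Σ3 (λ s → f s ℕ.* g (h · s))

  ⋆-cong : ∀ {f f′ g g′ : H → ℕ} → (∀ s → f s ≡ f′ s) → (∀ s → g s ≡ g′ s) → ∀ h → (f ⋆ g) h ≡ (f′ ⋆ g′) h
  ⋆-cong f≡ g≡ h = Σ3-cong (λ s → ≡.cong₂ ℕ._*_ (f≡ s) (g≡ (h · s)))

  ⋆-bilinear : ∀ (f f′ g g′ : H → ℕ) h → ((λ s → f s ℕ.+ f′ s) ⋆ (λ s → g s ℕ.+ g′ s)) h
               ≡ (f ⋆ g) h ℕ.+ (f ⋆ g′) h ℕ.+ ((f′ ⋆ g) h ℕ.+ (f′ ⋆ g′) h)
  ⋆-bilinear f f′ g g′ h = begin
    Σ3 (λ s → (f s ℕ.+ f′ s) ℕ.* (g (h · s) ℕ.+ g′ (h · s)))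
      ≡⟨ Σ3-cong (λ s → expand (f s) (f′ s) (g (h · s)) (g′ (h · s))) ⟩
    Σ3 (λ s → f s ℕ.* g (h · s) ℕ.+ f s ℕ.* g′ (h · s) ℕ.+ (f′ s ℕ.* g (h · s) ℕ.+ f′ s ℕ.* g′ (h · s)))
      ≡⟨ Σ3-+ _ _ ⟩
    Σ3 (λ s → f s ℕ.* g (h · s) ℕ.+ f s ℕ.* g′ (h · s)) ℕ.+ Σ3 (λ s → f′ s ℕ.* g (h · s) ℕ.+ f′ s ℕ.* g′ (h · s))
      ≡⟨ ≡.cong₂ ℕ._+_ (Σ3-+ _ _) (Σ3-+ _ _) ⟩
    (f ⋆ g) h ℕ.+ (f ⋆ g′) h ℕ.+ ((f′ ⋆ g) h ℕ.+ (f′ ⋆ g′) h) ∎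
    where
    expand : ∀ a a′ b b′ → (a ℕ.+ a′) ℕ.* (b ℕ.+ b′) ≡ a ℕ.* b ℕ.+ a ℕ.* b′ ℕ.+ (a′ ℕ.* b ℕ.+ a′ ℕ.* b′)
    expand = solve-∀

  ⋆-*ˡ : ∀ k (f g : H → ℕ) h → ((λ s → k ℕ.* f s) ⋆ g) h ≡ k ℕ.* (f ⋆ g) h
  ⋆-*ˡ k f g h = ≡.trans (Σ3-cong λ s → ℕ.*-assoc k (f s) (g (h · s))) (Σ3-*ˡ k _)

  ⋆-*ʳ : ∀ k (f g : H → ℕ) h → (f ⋆ (λ s → k ℕ.* g s)) h ≡ k ℕ.* (f ⋆ g) h
  ⋆-*ʳ k f g h = ≡.trans (Σ3-cong λ s → swap (f s) k (g (h · s))) (Σ3-*ˡ k _)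
    where
    swap : ∀ a k b → a ℕ.* (k ℕ.* b) ≡ k ℕ.* (a ℕ.* b)
    swap = solve-∀

  δH-cong : ∀ {s s′ t t′} → s ≈H s′ → t ≈H t′ → δH s t ≡ δH s′ t′
  δH-cong s≈ t≈ = ≡.cong 𝟙 (≟H-⇔ (λ s≈t → ≈H-trans (≈H-sym s≈) (≈H-trans s≈t t≈))
                                  (λ s′≈t′ → ≈H-trans s≈ (≈H-trans s′≈t′ (≈H-sym t≈))))

  ⋆-δeˡ : ∀ (f : H → ℕ) → (∀ {s t} → s ≈H t → f s ≡ f t) → ∀ h → ((λ s → δH s e) ⋆ f) h ≡ f h
  ⋆-δeˡ f f-resp h = begin
    Σ3 (λ s → δH s e ℕ.* f (h · s))   ≡⟨ Σ3-cong (λ s → ℕ.*-comm (δH s e) (f (h · s))) ⟩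
    Σ3 (λ s → f (h · s) ℕ.* δH s e)   ≡⟨ Σ3-δH (λ s → f (h · s)) (λ s≈t → f-resp (·-congˡ h s≈t)) e ⟩
    f (h · e)                         ≡⟨ f-resp (·-identityʳ h) ⟩
    f h                               ∎

  ⋆-δeʳ : ∀ (f : H → ℕ) → (∀ {s t} → s ≈H t → f s ≡ f t) → ∀ h → (f ⋆ (λ s → δH s e)) h ≡ f (h ⁻¹)
  ⋆-δeʳ f f-resp h = begin
    Σ3 (λ s → f s ℕ.* δH (h · s) e)   ≡⟨ Σ3-cong (λ s → ≡.cong (λ b → f s ℕ.* 𝟙 b) (≟H-⇔ (·≈e⇒ h s) (·≈e⇐ h s))) ⟩
    Σ3 (λ s → f s ℕ.* δH s (h ⁻¹))    ≡⟨ Σ3-δH f f-resp (h ⁻¹) ⟩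
    f (h ⁻¹)                          ∎

  card≡Σ3 : ∀ (S : H → Bool) → card S ≡ Σ3 (λ s → 𝟙 (S s))
  card≡Σ3 S = ≡.trans (length-filter S elems) (sum-elems (λ s → 𝟙 (S s)))

  coefSS⁻¹≡⋆ : ∀ (S : H → Bool) → (∀ {s t} → s ≈H t → S s ≡ S t) → ∀ g →
    coefSS⁻¹ S g ≡ ((λ s → 𝟙 (S s)) ⋆ (λ s → 𝟙 (S s))) (g ⁻¹)
  coefSS⁻¹≡⋆ S S-resp g = begin
    coefSS⁻¹ S g
      ≡⟨ length-filter (λ (s , t) → pair s t) pairs ⟩
    sum (map (λ (s , t) → 𝟙 (pair s t)) pairs)
      ≡⟨ sum-map-concatMap (λ (s , t) → 𝟙 (pair s t)) (λ s → map (s ,_) elems) elems ⟩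
    sum (map (λ s → sum (map (λ (s , t) → 𝟙 (pair s t)) (map (s ,_) elems))) elems)
      ≡⟨ sum-map-cong (λ s → ≡.trans (sum-map-map (λ (s , t) → 𝟙 (pair s t)) (s ,_) elems) (sum-elems (λ t → 𝟙 (pair s t)))) elems ⟩
    sum (map (λ s → Σ3 (λ t → 𝟙 (pair s t))) elems)
      ≡⟨ sum-elems (λ s → Σ3 (λ t → 𝟙 (pair s t))) ⟩
    Σ3 (λ s → Σ3 (λ t → 𝟙 (pair s t)))
      ≡⟨ Σ3-cong (λ s → ≡.trans (Σ3-cong (split s)) (Σ3-*ˡ (𝟙S s) (λ t → 𝟙S t ℕ.* δH t ((g ⁻¹) · s)))) ⟩
    Σ3 (λ s → 𝟙S s ℕ.* Σ3 (λ t → 𝟙S t ℕ.* δH t ((g ⁻¹) · s)))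
      ≡⟨ Σ3-cong (λ s → ≡.cong (𝟙S s ℕ.*_) (Σ3-δH 𝟙S (≡.cong 𝟙 ∘ S-resp) ((g ⁻¹) · s))) ⟩
    Σ3 (λ s → 𝟙S s ℕ.* 𝟙S ((g ⁻¹) · s))
      ∎
    where
    𝟙S : H → ℕ
    𝟙S s = 𝟙 (S s)
    pair : H → H → Bool
    pair s t = S s ∧ S t ∧ ((s · (t ⁻¹)) ≟H g)
    pairs : List (H × H)
    pairs = concatMap (λ s → map (s ,_) elems) elems
    split : ∀ s t → 𝟙 (pair s t) ≡ 𝟙S s ℕ.* (𝟙S t ℕ.* δH t ((g ⁻¹) · s))
    split s t = begin
      𝟙 (S s ∧ S t ∧ ((s · (t ⁻¹)) ≟H g))             ≡⟨ 𝟙-∧ (S s) _ ⟩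
      𝟙S s ℕ.* 𝟙 (S t ∧ ((s · (t ⁻¹)) ≟H g))          ≡⟨ ≡.cong (𝟙S s ℕ.*_) (𝟙-∧ (S t) _) ⟩
      𝟙S s ℕ.* (𝟙S t ℕ.* δH (s · (t ⁻¹)) g)
        ≡⟨ ≡.cong (λ b → 𝟙S s ℕ.* (𝟙S t ℕ.* 𝟙 b)) (≟H-⇔ (·⁻¹≈⇒ s t g) (·⁻¹≈⇐ s t g)) ⟩
      𝟙S s ℕ.* (𝟙S t ℕ.* δH t ((g ⁻¹) · s))           ∎

  coefRHS≡pdsCoefficient : ∀ S k λ′ μ g → (g ≟H e ≡ true → S g ≡ false) →
    coefRHS S k λ′ μ g ≡ + pdsCoefficient k λ′ μ (g ≟H e) (S g)
  coefRHS≡pdsCoefficient S k λ′ μ g e∉S with g ≟H e | S g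
  ... | true  | true  with () ← e∉S ≡.refl
  ... | true  | false = identity (+ k) (+ λ′) (+ μ)
    where
    identity : ∀ k l m → k ℤ.* ℤ.+ 1 ℤ.+ l ℤ.* ℤ.+ 0 ℤ.+ m ℤ.* (ℤ.+ 0 ℤ.- ℤ.+ 0) ≡ k
    identity = ℤ.solve-∀
  ... | false | true  = identity (+ k) (+ λ′) (+ μ)
    where
    identity : ∀ k l m → k ℤ.* ℤ.+ 0 ℤ.+ l ℤ.* ℤ.+ 1 ℤ.+ m ℤ.* (ℤ.+ 1 ℤ.- ℤ.+ 1) ≡ l
    identity = ℤ.solve-∀
  ... | false | false = identity (+ k) (+ λ′) (+ μ)
    where
    identity : ∀ k l m → k ℤ.* ℤ.+ 0 ℤ.+ l ℤ.* ℤ.+ 0 ℤ.+ m ℤ.* (ℤ.+ 1 ℤ.- ℤ.+ 0) ≡ m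
    identity = ℤ.solve-∀

module HeisenbergPDS {c ℓ q} (F : FiniteField c ℓ q) (1+1≉0 : CharacteristicNotTwo F) where

  open FiniteField F
  open FiniteFieldCounting F
  open Heisenberg F
  open HeisenbergCounting F
  open IntegerCoefficients commutativeRing using (solve; _:=_; _:+_; _:*_; :-_; _:-_; con)
  open ≡.≡-Reasoning

  inA : H → Bool
  inA (x , y , z) = does ((z + z) ≟ (x * y))

  inB : H → Bool
  inB (x , y , z) = does ((x ≟ 0#) ×-dec (y ≟ 0#))

  inS : H → Bool
  inS s = (inA s ∨ inB s) ∧ not (s ≟H e)

  𝟙A 𝟙B 𝟙S δe : H → ℕ
  𝟙A s = 𝟙 (inA s)
  𝟙B s = 𝟙 (inB s)
  𝟙S s = 𝟙 (inS s)
  δe s = δH s e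

  inA-cong : ∀ {s t} → s ≈H t → inA s ≡ inA t
  inA-cong {x , y , z} {x′ , y′ , z′} (x≈ , y≈ , z≈) =
    does-⇔ (≈-⇔ (+-cong z≈ z≈) (*-cong x≈ y≈)) ((z + z) ≟ (x * y)) ((z′ + z′) ≟ (x′ * y′))

  inB-cong : ∀ {s t} → s ≈H t → inB s ≡ inB t
  inB-cong {x , y , _} {x′ , y′ , _} (x≈ , y≈ , _) =
    does-⇔ (mk⇔ (λ (x≈0 , y≈0) → trans (sym x≈) x≈0 , trans (sym y≈) y≈0)
                (λ (x≈0 , y≈0) → trans x≈ x≈0 , trans y≈ y≈0))
           ((x ≟ 0#) ×-dec (y ≟ 0#)) ((x′ ≟ 0#) ×-dec (y′ ≟ 0#))

  ≟e-cong : ∀ {s t} → s ≈H t → s ≟H e ≡ t ≟H e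
  ≟e-cong s≈t = ≟H-⇔ (≈H-trans (≈H-sym s≈t)) (≈H-trans s≈t)

  inS-cong : ∀ {s t} → s ≈H t → inS s ≡ inS t
  inS-cong s≈t = ≡.cong₂ (λ a b → a ∧ not b) (≡.cong₂ _∨_ (inA-cong s≈t) (inB-cong s≈t)) (≟e-cong s≈t)

  inA-⁻¹ : ∀ g → inA (g ⁻¹) ≡ inA g
  inA-⁻¹ (x , y , z) = begin
    does (((- z + x * y) + (- z + x * y)) ≟ (- x * - y))  ≡⟨ does-⇔ (+-cancel-⇔ lhs rhs) (_ ≟ _) ((x * y) ≟ (z + z)) ⟩
    does ((x * y) ≟ (z + z))                               ≡⟨ does-⇔ (mk⇔ sym sym) ((x * y) ≟ (z + z)) ((z + z) ≟ (x * y)) ⟩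
    does ((z + z) ≟ (x * y))                               ∎
    where
    lhs : (- z + x * y) + (- z + x * y) ≈ (x * y - (z + z)) + x * y
    lhs = solve 3 (λ x y z → (:- z :+ x :* y) :+ (:- z :+ x :* y) := (x :* y :- (z :+ z)) :+ x :* y) refl x y z
    rhs : - x * - y ≈ (x * y - (z + z)) + (z + z)
    rhs = solve 3 (λ x y z → :- x :* :- y := (x :* y :- (z :+ z)) :+ (z :+ z)) refl x y z

  inB-⁻¹ : ∀ g → inB (g ⁻¹) ≡ inB g
  inB-⁻¹ (x , y , z) = does-⇔ (mk⇔ (λ (x≈0 , y≈0) → -x≈0⇒x≈0 x≈0 , -x≈0⇒x≈0 y≈0)
                                    (λ (x≈0 , y≈0) → x≈0⇒-x≈0 x≈0 , x≈0⇒-x≈0 y≈0))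
                               (((- x) ≟ 0#) ×-dec ((- y) ≟ 0#)) ((x ≟ 0#) ×-dec (y ≟ 0#))

  inS-⁻¹ : ∀ g → inS (g ⁻¹) ≡ inS g
  inS-⁻¹ g = ≡.cong₂ (λ a b → a ∧ not b) (≡.cong₂ _∨_ (inA-⁻¹ g) (inB-⁻¹ g)) (⁻¹≟e g)

  ∑-δ-halve : ∀ u → ∑ (λ z → δ (z + z) u) ≡ 1
  ∑-δ-halve u = ≡.trans (∑-cong λ z → δ-cong (solve 1 (λ z → z :+ z := (con (ℤ.+ 1) :+ con (ℤ.+ 1)) :* z :+ con (ℤ.+ 0)) refl z) refl)
                        (∑-δ-affine 0# u 1+1≉0)

  x+x≈0⇒x≈0 : ∀ {x} → x + x ≈ 0# → x ≈ 0#
  x+x≈0⇒x≈0 {x} x+x≈0 = *-cancel-≈0 1+1≉0 (trans (distribʳ x 1# 1#) (trans (+-cong (*-identityˡ x) (*-identityˡ x)) x+x≈0))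

  inA∧inB≡≟e : ∀ s → inA s ∧ inB s ≡ s ≟H e
  inA∧inB≡≟e s@(x , y , z) = begin
    does (A? ×-dec ((x ≟ 0#) ×-dec (y ≟ 0#)))  ≡⟨ does-⇔ (mk⇔ A∩B⇒e e⇒A∩B) (A? ×-dec ((x ≟ 0#) ×-dec (y ≟ 0#))) (s ≈H? e) ⟩
    does (s ≈H? e)                                ≡⟨ ≟H≡does s e ⟨
    s ≟H e                                        ∎
    where
    A? = (z + z) ≟ (x * y)
    x*y≈0 : x ≈ 0# → x * y ≈ 0#
    x*y≈0 x≈0 = trans (*-congʳ x≈0) (zeroˡ y)
    A∩B⇒e : (z + z ≈ x * y) × (x ≈ 0#) × (y ≈ 0#) → s ≈H e
    A∩B⇒e (2z≈xy , x≈0 , y≈0) = x≈0 , y≈0 , x+x≈0⇒x≈0 (trans 2z≈xy (x*y≈0 x≈0))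
    e⇒A∩B : s ≈H e → (z + z ≈ x * y) × (x ≈ 0#) × (y ≈ 0#)
    e⇒A∩B (x≈0 , y≈0 , z≈0) = trans (+-cong z≈0 z≈0) (trans (+-identityʳ 0#) (sym (x*y≈0 x≈0))) , x≈0 , y≈0

  𝟙S+2δe≡𝟙A+𝟙B : ∀ s → 𝟙S s ℕ.+ 2 ℕ.* δe s ≡ 𝟙A s ℕ.+ 𝟙B s
  𝟙S+2δe≡𝟙A+𝟙B s = ≡.trans (≡.cong (λ b → 𝟙 ((inA s ∨ inB s) ∧ not b) ℕ.+ 2 ℕ.* 𝟙 b) (≡.sym (inA∧inB≡≟e s)))
                            (𝟙-union (inA s) (inB s))

  Σ3-δe : Σ3 δe ≡ 1
  Σ3-δe = ≡.trans (Σ3-cong λ s → ≡.sym (ℕ.*-identityˡ (δe s))) (Σ3-δH (λ _ → 1) (λ _ → ≡.refl) e)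

  Σ3-𝟙A : Σ3 𝟙A ≡ q ℕ.* q
  Σ3-𝟙A = begin
    ∑ (λ x → ∑ (λ y → ∑ (λ z → δ (z + z) (x * y))))  ≡⟨ ∑-cong (λ x → ∑-cong λ y → ∑-δ-halve (x * y)) ⟩
    ∑ (λ x → ∑ (λ y → 1))                            ≡⟨ ∑-cong (λ x → ∑-const 1) ⟩
    ∑ (λ x → q ℕ.* 1)                                ≡⟨ ∑-const (q ℕ.* 1) ⟩
    q ℕ.* (q ℕ.* 1)                                  ≡⟨ ≡.cong (q ℕ.*_) (ℕ.*-identityʳ q) ⟩
    q ℕ.* q                                          ∎

  𝟙B-split : ∀ x y z → 𝟙B (x , y , z) ≡ δ x 0# ℕ.* δ y 0#
  𝟙B-split x y z = 𝟙-∧ (does (x ≟ 0#)) (does (y ≟ 0#))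

  Σ3-𝟙B : Σ3 𝟙B ≡ q
  Σ3-𝟙B = begin
    Σ3 𝟙B
      ≡⟨ ∑-cong (λ x → ∑-cong λ y → ∑-cong λ z → ≡.trans (𝟙B-split x y z) (≡.cong (δ x 0# ℕ.*_) (≡.sym (ℕ.*-identityʳ (δ y 0#))))) ⟩
    Σ3 (λ (x , y , _) → δ x 0# ℕ.* (δ y 0# ℕ.* 1))
      ≡⟨ Σ3-product (λ x → δ x 0#) (λ y → δ y 0#) (λ _ → 1) ⟩
    ∑ (λ x → δ x 0#) ℕ.* (∑ (λ y → δ y 0#) ℕ.* ∑ (λ _ → 1))
      ≡⟨ ≡.cong₂ ℕ._*_ (∑-δ-point 0#) (≡.cong₂ ℕ._*_ (∑-δ-point 0#) (∑-const 1)) ⟩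
    1 ℕ.* (1 ℕ.* (q ℕ.* 1))
      ≡⟨ ≡.trans (ℕ.*-identityˡ _) (≡.trans (ℕ.*-identityˡ _) (ℕ.*-identityʳ q)) ⟩
    q ∎

  Σ3-𝟙S : Σ3 𝟙S ℕ.+ 2 ≡ q ℕ.* q ℕ.+ q
  Σ3-𝟙S = begin
    Σ3 𝟙S ℕ.+ 2 ℕ.* 1                      ≡⟨ ≡.cong (λ n → Σ3 𝟙S ℕ.+ 2 ℕ.* n) Σ3-δe ⟨
    Σ3 𝟙S ℕ.+ 2 ℕ.* Σ3 δe                  ≡⟨ ≡.cong (Σ3 𝟙S ℕ.+_) (Σ3-*ˡ 2 δe) ⟨
    Σ3 𝟙S ℕ.+ Σ3 (λ s → 2 ℕ.* δe s)        ≡⟨ Σ3-+ 𝟙S (λ s → 2 ℕ.* δe s) ⟨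
    Σ3 (λ s → 𝟙S s ℕ.+ 2 ℕ.* δe s)         ≡⟨ Σ3-cong 𝟙S+2δe≡𝟙A+𝟙B ⟩
    Σ3 (λ s → 𝟙A s ℕ.+ 𝟙B s)               ≡⟨ Σ3-+ 𝟙A 𝟙B ⟩
    Σ3 𝟙A ℕ.+ Σ3 𝟙B                        ≡⟨ ≡.cong₂ ℕ._+_ Σ3-𝟙A Σ3-𝟙B ⟩
    q ℕ.* q ℕ.+ q                          ∎

  card-inS : card inS ≡ q ℕ.* q ℕ.+ q ℕ.∸ 2
  card-inS = begin
    card inS                     ≡⟨ card≡Σ3 inS ⟩
    Σ3 𝟙S                        ≡⟨ ℕ.m+n∸n≡m (Σ3 𝟙S) 2 ⟨
    Σ3 𝟙S ℕ.+ 2 ℕ.∸ 2            ≡⟨ ≡.cong (ℕ._∸ 2) Σ3-𝟙S ⟩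
    q ℕ.* q ℕ.+ q ℕ.∸ 2          ∎

  𝟙A⋆𝟙A-fibre : ∀ a b c x y → ∑ (λ z → 𝟙A (x , y , z) ℕ.* 𝟙A ((a , b , c) · (x , y , z))) ≡ δ (a * y + (c + c)) (a * b + b * x)
  𝟙A⋆𝟙A-fibre a b c x y = begin
    ∑ (λ z → δ (z + z) (x * y) ℕ.* δ (W z + W z) ((a + x) * (b + y)))
      ≡⟨ ∑-cong (λ z → 𝟙-guarded ((z + z) ≟ (x * y)) ((W z + W z) ≟ ((a + x) * (b + y)))
                                 ((a * y + (c + c)) ≟ (a * b + b * x)) (reduce z)) ⟩
    ∑ (λ z → δ (z + z) (x * y) ℕ.* D)                                  ≡⟨ ∑-*ʳ D (λ z → δ (z + z) (x * y)) ⟩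
    ∑ (λ z → δ (z + z) (x * y)) ℕ.* D                                  ≡⟨ ≡.cong (ℕ._* D) (∑-δ-halve (x * y)) ⟩
    1 ℕ.* D                                                            ≡⟨ ℕ.*-identityˡ D ⟩
    D                                                                  ∎
    where
    W : Carrier → Carrier
    W z = c + z + a * y
    D = δ (a * y + (c + c)) (a * b + b * x)
    -- given 2z = xy, both sides of 2(c + z + ay) = (a + x)(b + y) contain the summand xy + ay
    reduce : ∀ z → z + z ≈ x * y → (W z + W z ≈ (a + x) * (b + y)) ⇔ (a * y + (c + c) ≈ a * b + b * x)
    reduce z 2z≈xy = +-cancel-⇔
      (trans (solve 4 (λ a c y z → (c :+ z :+ a :* y) :+ (c :+ z :+ a :* y) := (z :+ z) :+ a :* y :+ (a :* y :+ (c :+ c))) refl a c y z)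
             (+-congʳ (+-congʳ 2z≈xy)))
      (solve 4 (λ a b x y → (a :+ x) :* (b :+ y) := x :* y :+ a :* y :+ (a :* b :+ b :* x)) refl a b x y)

  𝟙A⋆𝟙A-reduce : ∀ a b c → (𝟙A ⋆ 𝟙A) (a , b , c) ≡ ∑ (λ x → ∑ (λ y → δ (a * y + (c + c)) (a * b + b * x)))
  𝟙A⋆𝟙A-reduce a b c = ∑-cong λ x → ∑-cong λ y → 𝟙A⋆𝟙A-fibre a b c x y

  𝟙A⋆𝟙A-a≉0 : ∀ a b c → ¬ a ≈ 0# → (𝟙A ⋆ 𝟙A) (a , b , c) ≡ q
  𝟙A⋆𝟙A-a≉0 a b c a≉0 = begin
    (𝟙A ⋆ 𝟙A) (a , b , c)                                   ≡⟨ 𝟙A⋆𝟙A-reduce a b c ⟩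
    ∑ (λ x → ∑ (λ y → δ (a * y + (c + c)) (a * b + b * x)))  ≡⟨ ∑-cong (λ x → ∑-δ-affine (c + c) (a * b + b * x) a≉0) ⟩
    ∑ (λ x → 1)                                             ≡⟨ ∑-const 1 ⟩
    q ℕ.* 1                                                 ≡⟨ ℕ.*-identityʳ q ⟩
    q                                                       ∎

  𝟙A⋆𝟙A-b≉0 : ∀ a b c → ¬ b ≈ 0# → (𝟙A ⋆ 𝟙A) (a , b , c) ≡ q
  𝟙A⋆𝟙A-b≉0 a b c b≉0 = begin
    (𝟙A ⋆ 𝟙A) (a , b , c)                                   ≡⟨ 𝟙A⋆𝟙A-reduce a b c ⟩
    ∑ (λ x → ∑ (λ y → δ (a * y + (c + c)) (a * b + b * x)))  ≡⟨ ∑-swap (λ x y → δ (a * y + (c + c)) (a * b + b * x)) ⟩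
    ∑ (λ y → ∑ (λ x → δ (a * y + (c + c)) (a * b + b * x)))  ≡⟨ ∑-cong (λ y → ≡.trans (∑-cong (flip y)) (∑-δ-affine (a * b) (a * y + (c + c)) b≉0)) ⟩
    ∑ (λ y → 1)                                             ≡⟨ ∑-const 1 ⟩
    q ℕ.* 1                                                 ≡⟨ ℕ.*-identityʳ q ⟩
    q                                                       ∎
    where
    flip : ∀ y x → δ (a * y + (c + c)) (a * b + b * x) ≡ δ (b * x + a * b) (a * y + (c + c))
    flip y x = ≡.trans (δ-sym _ _) (δ-cong (+-comm (a * b) (b * x)) refl)

  𝟙A⋆𝟙A-centre : ∀ a b c → a ≈ 0# → b ≈ 0# → (𝟙A ⋆ 𝟙A) (a , b , c) ≡ q ℕ.* (q ℕ.* δ c 0#)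
  𝟙A⋆𝟙A-centre a b c a≈0 b≈0 = begin
    (𝟙A ⋆ 𝟙A) (a , b , c)                                   ≡⟨ 𝟙A⋆𝟙A-reduce a b c ⟩
    ∑ (λ x → ∑ (λ y → δ (a * y + (c + c)) (a * b + b * x)))  ≡⟨ ∑-cong (λ x → ∑-cong λ y → const x y) ⟩
    ∑ (λ x → ∑ (λ y → δ c 0#))                              ≡⟨ ∑-cong (λ x → ∑-const (δ c 0#)) ⟩
    ∑ (λ x → q ℕ.* δ c 0#)                                  ≡⟨ ∑-const (q ℕ.* δ c 0#) ⟩
    q ℕ.* (q ℕ.* δ c 0#)                                    ∎
    where
    a*u≈0 : ∀ u → a * u ≈ 0#
    a*u≈0 u = trans (*-congʳ a≈0) (zeroˡ u)
    c+c≈0⇔c≈0 : (c + c ≈ 0#) ⇔ (c ≈ 0#)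
    c+c≈0⇔c≈0 = mk⇔ x+x≈0⇒x≈0 (λ c≈0 → trans (+-cong c≈0 c≈0) (+-identityʳ 0#))
    const : ∀ x y → δ (a * y + (c + c)) (a * b + b * x) ≡ δ c 0#
    const x y = begin
      δ (a * y + (c + c)) (a * b + b * x)  ≡⟨ δ-cong (trans (+-congʳ (a*u≈0 y)) (+-identityˡ _))
                                                     (trans (+-cong (a*u≈0 b) (trans (*-congʳ b≈0) (zeroˡ x))) (+-identityʳ 0#)) ⟩
      δ (c + c) 0#                         ≡⟨ ≡.cong 𝟙 (does-⇔ c+c≈0⇔c≈0 ((c + c) ≟ 0#) (c ≟ 0#)) ⟩
      δ c 0#                               ∎

  𝟙A⋆𝟙B≡1 : ∀ h → (𝟙A ⋆ 𝟙B) h ≡ 1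
  𝟙A⋆𝟙B≡1 (a , b , c) = begin
    Σ3 (λ s → 𝟙A s ℕ.* 𝟙B ((a , b , c) · s))
      ≡⟨ ∑-cong (λ x → ∑-cong λ y → ∑-cong λ z → term x y z) ⟩
    Σ3 (λ (x , y , z) → δ (a + x) 0# ℕ.* (δ (b + y) 0# ℕ.* δ (z + z) (a * b)))
      ≡⟨ Σ3-product (λ x → δ (a + x) 0#) (λ y → δ (b + y) 0#) (λ z → δ (z + z) (a * b)) ⟩
    ∑ (λ x → δ (a + x) 0#) ℕ.* (∑ (λ y → δ (b + y) 0#) ℕ.* ∑ (λ z → δ (z + z) (a * b)))
      ≡⟨ ≡.cong₂ ℕ._*_ (∑-δ-shift a 0#) (≡.cong₂ ℕ._*_ (∑-δ-shift b 0#) (∑-δ-halve (a * b))) ⟩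
    1 ∎
    where
    term : ∀ x y z → 𝟙A (x , y , z) ℕ.* 𝟙B (a + x , b + y , c + z + a * y)
                     ≡ δ (a + x) 0# ℕ.* (δ (b + y) 0# ℕ.* δ (z + z) (a * b))
    term x y z = begin
      δ (z + z) (x * y) ℕ.* 𝟙 (does B?)          ≡⟨ ℕ.*-comm (δ (z + z) (x * y)) _ ⟩
      𝟙 (does B?) ℕ.* δ (z + z) (x * y)          ≡⟨ 𝟙-guarded B? ((z + z) ≟ (x * y)) ((z + z) ≟ (a * b)) xy≈ab ⟩
      𝟙 (does B?) ℕ.* δ (z + z) (a * b)          ≡⟨ ≡.cong (ℕ._* δ (z + z) (a * b)) (𝟙-∧ (does ((a + x) ≟ 0#)) _) ⟩
      δ (a + x) 0# ℕ.* δ (b + y) 0# ℕ.* δ (z + z) (a * b)  ≡⟨ ℕ.*-assoc (δ (a + x) 0#) _ _ ⟩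
      δ (a + x) 0# ℕ.* (δ (b + y) 0# ℕ.* δ (z + z) (a * b)) ∎
      where
      B? = ((a + x) ≟ 0#) ×-dec ((b + y) ≟ 0#)
      xy≈ab : (a + x ≈ 0#) × (b + y ≈ 0#) → (z + z ≈ x * y) ⇔ (z + z ≈ a * b)
      xy≈ab (a+x≈0 , b+y≈0) = ≈-⇔ refl (trans (*-cong (inverseʳ-unique a x a+x≈0) (inverseʳ-unique b y b+y≈0))
                                               (solve 2 (λ a b → :- a :* :- b := a :* b) refl a b))
        where open import Algebra.Properties.Group +-group using (inverseʳ-unique)

  𝟙B⋆𝟙A≡1 : ∀ h → (𝟙B ⋆ 𝟙A) h ≡ 1
  𝟙B⋆𝟙A≡1 (a , b , c) = begin
    Σ3 (λ s → 𝟙B s ℕ.* 𝟙A ((a , b , c) · s))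
      ≡⟨ ∑-cong (λ x → ∑-cong λ y → ∑-cong λ z → term x y z) ⟩
    Σ3 (λ (x , y , z) → δ x 0# ℕ.* (δ y 0# ℕ.* δ ((1# + 1#) * z + (c + c)) (a * b)))
      ≡⟨ Σ3-product (λ x → δ x 0#) (λ y → δ y 0#) (λ z → δ ((1# + 1#) * z + (c + c)) (a * b)) ⟩
    ∑ (λ x → δ x 0#) ℕ.* (∑ (λ y → δ y 0#) ℕ.* ∑ (λ z → δ ((1# + 1#) * z + (c + c)) (a * b)))
      ≡⟨ ≡.cong₂ ℕ._*_ (∑-δ-point 0#) (≡.cong₂ ℕ._*_ (∑-δ-point 0#) (∑-δ-affine (c + c) (a * b) 1+1≉0)) ⟩
    1 ∎
    where
    term : ∀ x y z → 𝟙B (x , y , z) ℕ.* 𝟙A (a + x , b + y , c + z + a * y)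
                     ≡ δ x 0# ℕ.* (δ y 0# ℕ.* δ ((1# + 1#) * z + (c + c)) (a * b))
    term x y z = begin
      𝟙 (does B?) ℕ.* δ (W + W) ((a + x) * (b + y))  ≡⟨ 𝟙-guarded B? ((W + W) ≟ ((a + x) * (b + y))) (L ≟ (a * b)) at-centre ⟩
      𝟙 (does B?) ℕ.* δ L (a * b)                    ≡⟨ ≡.cong (ℕ._* δ L (a * b)) (𝟙-∧ (does (x ≟ 0#)) _) ⟩
      δ x 0# ℕ.* δ y 0# ℕ.* δ L (a * b)              ≡⟨ ℕ.*-assoc (δ x 0#) _ _ ⟩
      δ x 0# ℕ.* (δ y 0# ℕ.* δ L (a * b))            ∎
      where
      B? = (x ≟ 0#) ×-dec (y ≟ 0#)
      W = c + z + a * y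
      L = (1# + 1#) * z + (c + c)
      at-centre : (x ≈ 0#) × (y ≈ 0#) → (W + W ≈ (a + x) * (b + y)) ⇔ (L ≈ a * b)
      at-centre (x≈0 , y≈0) = ≈-⇔
        (trans (solve 4 (λ a c y z → (c :+ z :+ a :* y) :+ (c :+ z :+ a :* y)
                                      := (con (ℤ.+ 1) :+ con (ℤ.+ 1)) :* z :+ (c :+ c) :+ (a :* y :+ a :* y)) refl a c y z)
               (trans (+-congˡ (trans (+-cong ay≈0 ay≈0) (+-identityʳ 0#))) (+-identityʳ _)))
        (trans (*-cong (trans (+-congˡ x≈0) (+-identityʳ a)) (trans (+-congˡ y≈0) (+-identityʳ b))) refl)
        where
        ay≈0 : a * y ≈ 0#
        ay≈0 = trans (*-congˡ y≈0) (zeroʳ a)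

  𝟙B⋆𝟙B≡𝟙B*q : ∀ h → (𝟙B ⋆ 𝟙B) h ≡ 𝟙B h ℕ.* q
  𝟙B⋆𝟙B≡𝟙B*q h@(a , b , c) = begin
    Σ3 (λ s → 𝟙B s ℕ.* 𝟙B (h · s))   ≡⟨ ∑-cong (λ x → ∑-cong λ y → ∑-cong λ z → term x y z) ⟩
    Σ3 (λ s → 𝟙B h ℕ.* 𝟙B s)         ≡⟨ Σ3-*ˡ (𝟙B h) 𝟙B ⟩
    𝟙B h ℕ.* Σ3 𝟙B                   ≡⟨ ≡.cong (𝟙B h ℕ.*_) Σ3-𝟙B ⟩
    𝟙B h ℕ.* q                       ∎
    where
    term : ∀ x y z → 𝟙B (x , y , z) ℕ.* 𝟙B (a + x , b + y , c + z + a * y) ≡ 𝟙B h ℕ.* 𝟙B (x , y , z)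
    term x y z = ≡.trans (𝟙-guarded ((x ≟ 0#) ×-dec (y ≟ 0#)) (((a + x) ≟ 0#) ×-dec ((b + y) ≟ 0#))
                                    ((a ≟ 0#) ×-dec (b ≟ 0#)) at-centre)
                         (ℕ.*-comm (𝟙B (x , y , z)) (𝟙B h))
      where
      at-centre : (x ≈ 0#) × (y ≈ 0#) → ((a + x ≈ 0#) × (b + y ≈ 0#)) ⇔ ((a ≈ 0#) × (b ≈ 0#))
      at-centre (x≈0 , y≈0) = mk⇔ (λ (a+x≈0 , b+y≈0) → trans (sym a+x≈a) a+x≈0 , trans (sym b+y≈b) b+y≈0)
                                  (λ (a≈0 , b≈0) → trans a+x≈a a≈0 , trans b+y≈b b≈0)
        where
        a+x≈a = trans (+-congˡ x≈0) (+-identityʳ a)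
        b+y≈b = trans (+-congˡ y≈0) (+-identityʳ b)

  𝟙A⋆𝟙A+𝟙B*q : ∀ h → (𝟙A ⋆ 𝟙A) h ℕ.+ 𝟙B h ℕ.* q ≡ q ℕ.+ q ℕ.* (q ℕ.* δe h)
  𝟙A⋆𝟙A+𝟙B*q h@(a , b , c) = begin
    (𝟙A ⋆ 𝟙A) h ℕ.+ 𝟙B h ℕ.* q                       ≡⟨ ≡.cong (λ n → (𝟙A ⋆ 𝟙A) h ℕ.+ n ℕ.* q) (𝟙B-split a b c) ⟩
    (𝟙A ⋆ 𝟙A) h ℕ.+ δ a 0# ℕ.* δ b 0# ℕ.* q           ≡⟨ by-cases ⟩
    q ℕ.+ q ℕ.* (q ℕ.* (δ a 0# ℕ.* (δ b 0# ℕ.* δ c 0#))) ≡⟨ ≡.cong (λ n → q ℕ.+ q ℕ.* (q ℕ.* n)) (δH-split a b c 0# 0# 0#) ⟨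
    q ℕ.+ q ℕ.* (q ℕ.* δe h)                         ∎
    where
    off-centre : q ℕ.+ 0 ≡ q ℕ.+ q ℕ.* (q ℕ.* 0)
    off-centre = ≡.cong (q ℕ.+_) (≡.sym (≡.trans (≡.cong (q ℕ.*_) (ℕ.*-zeroʳ q)) (ℕ.*-zeroʳ q)))
    centre : ∀ q d → q ℕ.* (q ℕ.* d) ℕ.+ 1 ℕ.* q ≡ q ℕ.+ q ℕ.* (q ℕ.* (1 ℕ.* (1 ℕ.* d)))
    centre = solve-∀
    by-cases : (𝟙A ⋆ 𝟙A) h ℕ.+ δ a 0# ℕ.* δ b 0# ℕ.* q ≡ q ℕ.+ q ℕ.* (q ℕ.* (δ a 0# ℕ.* (δ b 0# ℕ.* δ c 0#)))
    by-cases with a ≟ 0# | b ≟ 0#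
    ... | no a≉0  | _       = ≡.trans (≡.cong (ℕ._+ 0) (𝟙A⋆𝟙A-a≉0 a b c a≉0)) off-centre
    ... | yes a≈0 | no b≉0  = ≡.trans (≡.cong (ℕ._+ 0) (𝟙A⋆𝟙A-b≉0 a b c b≉0)) off-centre
    ... | yes a≈0 | yes b≈0 = ≡.trans (≡.cong (ℕ._+ 1 ℕ.* 1 ℕ.* q) (𝟙A⋆𝟙A-centre a b c a≈0 b≈0)) (centre q (δ c 0#))

  expansion : ∀ h → (𝟙S ⋆ 𝟙S) h ℕ.+ 2 ℕ.* 𝟙S h ℕ.+ (2 ℕ.* 𝟙S h ℕ.+ 2 ℕ.* (2 ℕ.* δe h))
                       ≡ (𝟙A ⋆ 𝟙A) h ℕ.+ 1 ℕ.+ (1 ℕ.+ 𝟙B h ℕ.* q)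
  expansion h = begin
    (𝟙S ⋆ 𝟙S) h ℕ.+ 2 ℕ.* 𝟙S h ℕ.+ (2 ℕ.* 𝟙S h ℕ.+ 2 ℕ.* (2 ℕ.* δe h))
      ≡⟨ ≡.cong₂ (λ a b → (𝟙S ⋆ 𝟙S) h ℕ.+ a ℕ.+ b) S⋆2δe (≡.cong₂ ℕ._+_ 2δe⋆S 2δe⋆2δe) ⟨
    (𝟙S ⋆ 𝟙S) h ℕ.+ (𝟙S ⋆ 2δe) h ℕ.+ ((2δe ⋆ 𝟙S) h ℕ.+ (2δe ⋆ 2δe) h)
      ≡⟨ ⋆-bilinear 𝟙S 2δe 𝟙S 2δe h ⟨
    ((λ s → 𝟙S s ℕ.+ 2δe s) ⋆ (λ s → 𝟙S s ℕ.+ 2δe s)) h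
      ≡⟨ ⋆-cong 𝟙S+2δe≡𝟙A+𝟙B 𝟙S+2δe≡𝟙A+𝟙B h ⟩
    ((λ s → 𝟙A s ℕ.+ 𝟙B s) ⋆ (λ s → 𝟙A s ℕ.+ 𝟙B s)) h
      ≡⟨ ⋆-bilinear 𝟙A 𝟙B 𝟙A 𝟙B h ⟩
    (𝟙A ⋆ 𝟙A) h ℕ.+ (𝟙A ⋆ 𝟙B) h ℕ.+ ((𝟙B ⋆ 𝟙A) h ℕ.+ (𝟙B ⋆ 𝟙B) h)
      ≡⟨ ≡.cong₂ (λ a b → (𝟙A ⋆ 𝟙A) h ℕ.+ a ℕ.+ b) (𝟙A⋆𝟙B≡1 h) (≡.cong₂ ℕ._+_ (𝟙B⋆𝟙A≡1 h) (𝟙B⋆𝟙B≡𝟙B*q h)) ⟩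
    (𝟙A ⋆ 𝟙A) h ℕ.+ 1 ℕ.+ (1 ℕ.+ 𝟙B h ℕ.* q)
      ∎
    where
    2δe : H → ℕ
    2δe s = 2 ℕ.* δe s
    𝟙S-resp : ∀ {s t} → s ≈H t → 𝟙S s ≡ 𝟙S t
    𝟙S-resp = ≡.cong 𝟙 ∘ inS-cong
    δe-resp : ∀ {s t} → s ≈H t → δe s ≡ δe t
    δe-resp s≈t = δH-cong s≈t ≈H-refl
    S⋆2δe : (𝟙S ⋆ 2δe) h ≡ 2 ℕ.* 𝟙S h
    S⋆2δe = ≡.trans (⋆-*ʳ 2 𝟙S δe h) (≡.cong (2 ℕ.*_) (≡.trans (⋆-δeʳ 𝟙S 𝟙S-resp h) (≡.cong 𝟙 (inS-⁻¹ h))))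
    2δe⋆S : (2δe ⋆ 𝟙S) h ≡ 2 ℕ.* 𝟙S h
    2δe⋆S = ≡.trans (⋆-*ˡ 2 δe 𝟙S h) (≡.cong (2 ℕ.*_) (⋆-δeˡ 𝟙S 𝟙S-resp h))
    2δe⋆2δe : (2δe ⋆ 2δe) h ≡ 2 ℕ.* (2 ℕ.* δe h)
    2δe⋆2δe = ≡.trans (⋆-*ˡ 2 δe 2δe h)
                (≡.cong (2 ℕ.*_) (≡.trans (⋆-*ʳ 2 δe δe h) (≡.cong (2 ℕ.*_) (⋆-δeˡ δe δe-resp h))))

  𝟙S⋆𝟙S+4𝟙S+4δe : ∀ h → (𝟙S ⋆ 𝟙S) h ℕ.+ 4 ℕ.* 𝟙S h ℕ.+ 4 ℕ.* δe h ≡ q ℕ.+ q ℕ.* (q ℕ.* δe h) ℕ.+ 2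
  𝟙S⋆𝟙S+4𝟙S+4δe h = begin
    (𝟙S ⋆ 𝟙S) h ℕ.+ 4 ℕ.* 𝟙S h ℕ.+ 4 ℕ.* δe h                                ≡⟨ regroupˡ ((𝟙S ⋆ 𝟙S) h) (𝟙S h) (δe h) ⟩
    (𝟙S ⋆ 𝟙S) h ℕ.+ 2 ℕ.* 𝟙S h ℕ.+ (2 ℕ.* 𝟙S h ℕ.+ 2 ℕ.* (2 ℕ.* δe h))      ≡⟨ expansion h ⟩
    (𝟙A ⋆ 𝟙A) h ℕ.+ 1 ℕ.+ (1 ℕ.+ 𝟙B h ℕ.* q)                                 ≡⟨ regroupʳ ((𝟙A ⋆ 𝟙A) h) (𝟙B h ℕ.* q) ⟩
    (𝟙A ⋆ 𝟙A) h ℕ.+ 𝟙B h ℕ.* q ℕ.+ 2                                         ≡⟨ ≡.cong (ℕ._+ 2) (𝟙A⋆𝟙A+𝟙B*q h) ⟩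
    q ℕ.+ q ℕ.* (q ℕ.* δe h) ℕ.+ 2                                           ∎
    where
    regroupˡ : ∀ n s d → n ℕ.+ 4 ℕ.* s ℕ.+ 4 ℕ.* d ≡ n ℕ.+ 2 ℕ.* s ℕ.+ (2 ℕ.* s ℕ.+ 2 ℕ.* (2 ℕ.* d))
    regroupˡ = solve-∀
    regroupʳ : ∀ a b → a ℕ.+ 1 ℕ.+ (1 ℕ.+ b) ≡ a ℕ.+ b ℕ.+ 2
    regroupʳ = solve-∀

  e∉S : ∀ g → g ≟H e ≡ true → inS g ≡ false
  e∉S g g≟e = ≡.trans (≡.cong (λ b → (inA g ∨ inB g) ∧ not b) g≟e) (∧-zeroʳ (inA g ∨ inB g))

  S : Subset
  S = inS , λ _ _ → inS-cong

  coefSS⁻¹≡coefRHS : ∀ g → ℤ.+ coefSS⁻¹ inS g ≡ coefRHS inS (q ℕ.* q ℕ.+ q ℕ.∸ 2) (q ℕ.∸ 2) (q ℕ.+ 2) g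
  coefSS⁻¹≡coefRHS g = begin
    ℤ.+ coefSS⁻¹ inS g
      ≡⟨ ≡.cong ℤ.+_ (coefSS⁻¹≡⋆ inS inS-cong g) ⟩
    ℤ.+ (𝟙S ⋆ 𝟙S) (g ⁻¹)
      ≡⟨ ≡.cong ℤ.+_ (pdsCoefficient-from-count q _ ((g ⁻¹) ≟H e) (inS (g ⁻¹)) (e∉S (g ⁻¹)) (𝟙S⋆𝟙S+4𝟙S+4δe (g ⁻¹))) ⟩
    ℤ.+ value ((g ⁻¹) ≟H e) (inS (g ⁻¹))
      ≡⟨ ≡.cong₂ (λ a b → ℤ.+ value a b) (⁻¹≟e g) (inS-⁻¹ g) ⟩
    ℤ.+ value (g ≟H e) (inS g)
      ≡⟨ coefRHS≡pdsCoefficient inS _ _ _ g (e∉S g) ⟨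
    coefRHS inS (q ℕ.* q ℕ.+ q ℕ.∸ 2) (q ℕ.∸ 2) (q ℕ.+ 2) g ∎
    where
    value = pdsCoefficient (q ℕ.* q ℕ.+ q ℕ.∸ 2) (q ℕ.∸ 2) (q ℕ.+ 2)

  isPDS : IsPDS S (q ℕ.^ 3) (q ℕ.* q ℕ.+ q ℕ.∸ 2) (q ℕ.∸ 2) (q ℕ.+ 2)
  isPDS = length-elems , card-inS , coefSS⁻¹≡coefRHS

  isReversible : IsReversible S
  isReversible = inS-⁻¹

open import Data.Nat using (_+_; _*_; _∸_; _^_; _%_)

corollary6p5 : ∀ {c ℓ : Level} (q : ℕ) → IsPrimePower q → q % 2 ≡ 1 →
    (F : FiniteField c ℓ q) →
    Σ (Heisenberg.Subset F) λ S →
      Heisenberg.IsPDS F S (q ^ 3) (q * q + q ∸ 2) (q ∸ 2) (q + 2)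
      × Heisenberg.IsReversible F S
corollary6p5 q _ q-odd F = S , isPDS , isReversible
  where open HeisenbergPDS F (FiniteFieldCounting.odd-order⇒1+1≉0 F q-odd)
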